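{- Let $n\ge 2$ and $1\le k\le n-1$, and let $G$ be a connected simple graph of order $n$ with edge connectivity $k$. Then $Z(G)\le Z(K^k_{n-1,1})$, with equality if and only if $G\cong K^k_{n-1,1}$.
   Context: For a simple graph $G$, $m(G,t)$ denotes the number of $t$-matchings (sets of $t$ pairwise disjoint edges) of $G$, with $m(G,0)=1$. The Hosoya index of $G$ is $Z(G)=\sum_{t\ge 0} m(G,t)$. $K^k_{n-1,1}$ denotes the graph obtained from the disjoint union $K_1\cup K_{n-1}$ by adding $k$ edges between the vertex of $K_1$ and $k$ distinct vertices of $K_{n-1}$. -}

module Defs where

open import Data.Nat using (ℕ; zero; suc; _≤ᵇ_; _<ᵇ_; _≡ᵇ_)
open import Data.Bool using (Bool; true; false; not; _∧_; _∨_; if_then_else_)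
open import Data.Fin using (Fin; zero; suc; toℕ; _≟_)
open import Data.List using (List; []; _∷_; map; _++_; concatMap; allFin; length)
open import Data.Bool.ListAction using (all; any)
open import Data.Product using (_×_; _,_; proj₁; proj₂)
open import Relation.Nullary using (yes; no)
open import Relation.Nullary.Decidable using (⌊_⌋)
open import Relation.Binary.PropositionalEquality using (_≡_; refl)
open import Function.Bundles using (_↔_; Inverse)

record Graph (n : ℕ) : Set where
  field
    adj    : Fin n → Fin n → Bool
    sym    : ∀ u v → adj u v ≡ adj v u
    irrefl : ∀ u → adj u u ≡ false
open Graph public

Adj : ℕ → Set
Adj n = Fin n → Fin n → Bool

data Reach {n : ℕ} (a : Adj n) : Fin n → Fin n → Set where
  here : ∀ {u} → Reach a u u
  step : ∀ {u v w} → a u v ≡ true → Reach a v w → Reach a u w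

ConnectedAdj : {n : ℕ} → Adj n → Set
ConnectedAdj {n} a = ∀ (u v : Fin n) → Reach a u v

Connected : {n : ℕ} → Graph n → Set
Connected G = ConnectedAdj (adj G)

_==_ : {n : ℕ} → Fin n → Fin n → Bool
i == j = ⌊ i ≟ j ⌋

-- An unordered pair {u,v} given as an ordered pair, in either orientation.
Pair : ℕ → Set
Pair n = Fin n × Fin n

memPair : {n : ℕ} → Fin n → Fin n → Pair n → Bool
memPair u v (a , b) = ((a == u) ∧ (b == v)) ∨ ((a == v) ∧ (b == u))

deleteEdges : {n : ℕ} → Graph n → List (Pair n) → Adj n
deleteEdges G F u v = adj G u v ∧ not (any (memPair u v) F)

EdgeConnectivity : {n : ℕ} → Graph n → ℕ → Set
EdgeConnectivity {n} G k =
  (∀ (F : List (Pair n)) → suc (length F) Data.Nat.≤ k → ConnectedAdj (deleteEdges G F))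
  × Data.Product.Σ (List (Pair n)) (λ F → (length F ≡ k) × (ConnectedAdj (deleteEdges G F) → Data.Empty.⊥))
  where import Data.Empty; import Data.Nat

pairs : (n : ℕ) → List (Pair n)
pairs n = concatMap (λ i → concatMap (λ j → if toℕ i <ᵇ toℕ j then (i , j) ∷ [] else []) (allFin n)) (allFin n)

sublists : {A : Set} → List A → List (List A)
sublists [] = [] ∷ []
sublists (x ∷ xs) = map (x ∷_) (sublists xs) ++ sublists xs

disjointᵇ : {n : ℕ} → Pair n → Pair n → Bool
disjointᵇ (a , b) (c , d) = not ((a == c) ∨ (a == d) ∨ (b == c) ∨ (b == d))

isMatching : {n : ℕ} → Graph n → List (Pair n) → Bool
isMatching G [] = true
isMatching G (e ∷ M) = adj G (proj₁ e) (proj₂ e) ∧ all (disjointᵇ e) M ∧ isMatching G M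

count : {A : Set} → (A → Bool) → List A → ℕ
count p [] = 0
count p (x ∷ xs) = if p x then suc (count p xs) else count p xs

m : {n : ℕ} → Graph n → ℕ → ℕ
m {n} G t = count (λ M → isMatching G M ∧ (length M ≡ᵇ t)) (sublists (pairs n))

-- Hosoya index Z(G) = Σ_{t ≥ 0} m(G,t) = total number of matchings (incl. the empty one).
Z : {n : ℕ} → Graph n → ℕ
Z {n} G = count (isMatching G) (sublists (pairs n))

-- K^k_{n-1,1}: vertex 0 is the K_1, vertices 1..n-1 form K_{n-1},
-- and 0 is joined to the k vertices 1..k.
adjK : {n : ℕ} → ℕ → Adj n
adjK k zero zero = false
adjK k zero (suc j) = suc (toℕ j) ≤ᵇ k
adjK k (suc i) zero = suc (toℕ i) ≤ᵇ k
adjK k (suc i) (suc j) = not (i == j)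

adjK-sym : {n : ℕ} (k : ℕ) (u v : Fin n) → adjK k u v ≡ adjK k v u
adjK-sym k zero zero = refl
adjK-sym k zero (suc j) = refl
adjK-sym k (suc i) zero = refl
adjK-sym k (suc i) (suc j) with i ≟ j | j ≟ i
... | yes _ | yes _ = refl
... | no _ | no _ = refl
... | yes refl | no ¬p = Data.Empty.⊥-elim (¬p refl) where import Data.Empty
... | no ¬p | yes refl = Data.Empty.⊥-elim (¬p refl) where import Data.Empty

adjK-irrefl : {n : ℕ} (k : ℕ) (u : Fin n) → adjK k u u ≡ false
adjK-irrefl k zero = refl
adjK-irrefl k (suc i) with i ≟ i
... | yes _ = refl
... | no ¬p = Data.Empty.⊥-elim (¬p refl) where import Data.Empty

K : (n k : ℕ) → Graph n
K n k = record { adj = adjK k ; sym = adjK-sym k ; irrefl = adjK-irrefl k }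

_≅_ : {n : ℕ} → Graph n → Graph n → Set
_≅_ {n} G H = Data.Product.Σ (Fin n ↔ Fin n) (λ σ → ∀ u v → adj G u v ≡ adj H (Inverse.to σ u) (Inverse.to σ v))
  where import Data.Product

-- Let F be a set of k edges disconnecting G, and S the set of vertices
-- reachable from 0 in G − F; S is a cut of size s, its complement has size t.
-- Every edge of G either stays on one side of S or crosses it and lies in F, so
-- G is a subgraph of the cover K_S ∪ K_{Sᶜ} ∪ (crossing pairs of F), and Z is
-- monotone under adding edges.  Adding the crossing pairs one by one with the
-- edge recurrence Z(H) = Z(H − pq) + Z(H − p − q) costs at most Z(K_{n-2}) each,
-- and Z(K_S ∪ K_{Sᶜ}) = Z(K_s)·Z(K_t) ≤ Z(K_{n-1}); the vertex recurrence at the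
-- apex gives Z(K^k_{n-1,1}) = Z(K_{n-1}) + k·Z(K_{n-2}).  This is the bound.
-- If s, t ≥ 2 a crossing edge of G (G is connected) has contraction term
-- Z(K_{s-1})·Z(K_{t-1}) < Z(K_{n-2}), so the bound is strict.  Otherwise one side
-- is a single vertex w, equality forces G to be the whole cover, a cone over
-- K_{n-1} with apex w whose degree is k, and such a cone is relabelled into
-- K^k_{n-1,1} by transpositions.

module Submission where

open import Defs
open import Data.Nat using (ℕ; _≤_; _∸_)
open import Data.Product using (_×_)
open import Function.Bundles using (_⇔_)
open import Relation.Binary.PropositionalEquality using (_≡_)

open import Data.Nat using (zero; suc; _+_; _*_; _<_; z≤n; s≤s; _<ᵇ_; _≤ᵇ_; _≤?_; >-nonZero)
open import Data.Nat.Properties hiding (_≟_)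
open import Data.Nat.Tactic.RingSolver using (solve-∀)
open import Data.Bool using (Bool; true; false; not; _∧_; _∨_; _xor_; if_then_else_; T) renaming (_≟_ to _≟ᵇ_)
open import Data.Bool.Properties using (∧-comm; ∨-comm; ∧-zeroʳ; ∧-identityʳ; ¬-not)
open import Data.Bool.Solver using (module ∨-∧-Solver)
open import Data.Bool.ListAction using (all; any)
open import Data.Fin using (Fin; zero; suc; toℕ; _≟_)
import Data.Fin.Properties as Fin
open import Data.List using (List; []; _∷_; map; _++_; concatMap; allFin; length; tabulate)
open import Data.List.Relation.Unary.All using (All; []; _∷_)
import Data.List.Relation.Unary.All as All
open import Data.List.Relation.Unary.All.Properties using (++⁺)
open import Data.List.Properties using (map-tabulate)
open import Data.Nat.ListAction renaming (sum to listSum)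
open import Data.List.Relation.Unary.AllPairs.Core using (_∷_)
open import Data.List.Relation.Unary.Unique.Propositional using (Unique)
open import Data.List.Relation.Unary.Unique.Propositional.Properties using (allFin⁺)
open import Data.Product using (_,_; proj₁; proj₂; Σ)
open import Data.Sum using (_⊎_; inj₁; inj₂)
open import Data.Empty using (⊥; ⊥-elim)
open import Relation.Nullary using (yes; no; Dec)
import Relation.Binary.PropositionalEquality as ≡
open import Relation.Binary.PropositionalEquality
  using (refl; trans; cong; cong₂; subst; _≢_; module ≡-Reasoning)
open import Relation.Binary.Definitions using (tri<; tri≈; tri>)
open import Function.Bundles using (_↔_; Inverse; mk⇔)
open import Function.Construct.Composition using (_↔-∘_)
open import Function.Construct.Identity using (↔-id)
open import Function.Construct.Symmetry using (↔-sym)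
open import Data.Fin.Permutation using (transpose)
open import Relation.Nullary.Decidable using (dec-true; dec-false)
open import Algebra.Properties.CommutativeMonoid.Sum +-0-commutativeMonoid
  using (sum; sum-cong-≗; sum-permute)

open ∨-∧-Solver using (solve; _:=_; _:+_; _:*_)

∧-true : ∀ {a b} → a ∧ b ≡ true → (a ≡ true) × (b ≡ true)
∧-true {true} {true} _ = refl , refl

not-true : ∀ {b} → not b ≡ true → b ≡ false
not-true {false} _ = refl

not-false : ∀ {b} → not b ≡ false → b ≡ true
not-false {true} _ = refl

true≢false : true ≢ false
true≢false ()

==-refl : ∀ {n} (i : Fin n) → (i == i) ≡ true
==-refl i with i ≟ i
... | yes _ = refl
... | no i≢i = ⊥-elim (i≢i refl)

==⇒≡ : ∀ {n} {i j : Fin n} → (i == j) ≡ true → i ≡ j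
==⇒≡ {i = i} {j} h with i ≟ j
... | yes i≡j = i≡j

≢⇒==false : ∀ {n} {i j : Fin n} → i ≢ j → (i == j) ≡ false
≢⇒==false {i = i} {j} i≢j with i ≟ j
... | yes i≡j = ⊥-elim (i≢j i≡j)
... | no _ = refl

==false⇒≢ : ∀ {n} {i j : Fin n} → (i == j) ≡ false → i ≢ j
==false⇒≢ {i = i} h refl = true≢false (trans (≡.sym (==-refl i)) h)

==-sym : ∀ {n} (i j : Fin n) → (i == j) ≡ (j == i)
==-sym i j with i ≟ j
... | yes refl = ≡.sym (==-refl i)
... | no i≢j = ≡.sym (≢⇒==false (λ j≡i → i≢j (≡.sym j≡i)))

==-injective : ∀ {m n} (f : Fin m → Fin n) → (∀ u v → f u ≡ f v → u ≡ v) →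
  ∀ u v → (f u == f v) ≡ (u == v)
==-injective f inj u v with u ≟ v
... | yes refl = ==-refl (f u)
... | no u≢v = ≢⇒==false (λ e → u≢v (inj u v e))

==-suc : ∀ {n} (i j : Fin n) → (suc i == suc j) ≡ (i == j)
==-suc = ==-injective suc (λ _ _ → Fin.suc-injective)

count-++ : ∀ {A : Set} (p : A → Bool) (xs ys : List A) →
  count p (xs ++ ys) ≡ count p xs + count p ys
count-++ p [] ys = refl
count-++ p (x ∷ xs) ys with p x
... | true = cong suc (count-++ p xs ys)
... | false = count-++ p xs ys

count-map : ∀ {A B : Set} (p : B → Bool) (f : A → B) (xs : List A) →
  count p (map f xs) ≡ count (λ x → p (f x)) xs
count-map p f [] = refl
count-map p f (x ∷ xs) with p (f x)
... | true = cong suc (count-map p f xs)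
... | false = count-map p f xs

count-cong : ∀ {A : Set} {p q : A → Bool} (xs : List A) → (∀ x → p x ≡ q x) →
  count p xs ≡ count q xs
count-cong [] h = refl
count-cong {q = q} (x ∷ xs) h rewrite h x with q x
... | true = cong suc (count-cong xs h)
... | false = count-cong xs h

count-false : ∀ {A : Set} (xs : List A) → count (λ _ → false) xs ≡ 0
count-false [] = refl
count-false (x ∷ xs) = count-false xs

count≡0 : ∀ {A : Set} (p : A → Bool) (xs : List A) → count p xs ≡ 0 →
  All (λ x → p x ≡ false) xs
count≡0 p [] h = []
count≡0 p (x ∷ xs) h with p x in px
... | false = px ∷ count≡0 p xs h

count-concatMap-tabulate : ∀ {n} {A B : Set} (p : B → Bool) (f : A → List B) (g : Fin n → A) →
  count p (concatMap f (tabulate g)) ≡ sum (λ i → count p (f (g i)))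
count-concatMap-tabulate {zero} p f g = refl
count-concatMap-tabulate {suc n} p f g =
  trans (count-++ p (f (g zero)) _) (cong (count p (f (g zero)) +_) (count-concatMap-tabulate p f (λ i → g (suc i))))

-- An edge predicate P plays the
-- role of an edge set; matchings P L counts the sublists of L that are matchings
-- of P.  For L = pairs n this is the Hosoya index (see Z≡Zᵃ).

EdgePred : ℕ → Set
EdgePred n = Pair n → Bool

infixl 7 _∧ᵖ_
_∧ᵖ_ : ∀ {n} → EdgePred n → EdgePred n → EdgePred n
(P ∧ᵖ Q) e = P e ∧ Q e

samePair : ∀ {n} → Pair n → Pair n → Bool
samePair (u , v) (i , j) = (u == i) ∧ (v == j)

samePair-refl : ∀ {n} (e : Pair n) → samePair e e ≡ true
samePair-refl (u , v) rewrite ==-refl u | ==-refl v = refl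

samePair⇒≡ : ∀ {n} {e f : Pair n} → samePair e f ≡ true → e ≡ f
samePair⇒≡ {e = u , v} {i , j} h with ∧-true {u == i} h
... | u=i , v=j rewrite ==⇒≡ {i = u} u=i | ==⇒≡ {i = v} v=j = refl

_─_ : ∀ {n} → EdgePred n → Pair n → EdgePred n
(P ─ e) f = P f ∧ not (samePair e f)

isMatchingᵖ : ∀ {n} → EdgePred n → List (Pair n) → Bool
isMatchingᵖ P [] = true
isMatchingᵖ P (e ∷ M) = P e ∧ all (disjointᵇ e) M ∧ isMatchingᵖ P M

matchings : ∀ {n} → EdgePred n → List (Pair n) → ℕ
matchings P L = count (isMatchingᵖ P) (sublists L)

when : Bool → ℕ → ℕ
when b x = if b then x else 0

isMatchingᵖ-∧ : ∀ {n} (P Q : EdgePred n) M → isMatchingᵖ (P ∧ᵖ Q) M ≡ all Q M ∧ isMatchingᵖ P M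
isMatchingᵖ-∧ P Q [] = refl
isMatchingᵖ-∧ P Q (e ∷ M) rewrite isMatchingᵖ-∧ P Q M =
  solve 5 (λ p q d a m → (p :* q) :* (d :* (a :* m)) := (q :* a) :* (p :* (d :* m))) refl
    (P e) (Q e) (all (disjointᵇ e) M) (all Q M) (isMatchingᵖ P M)

matchings-cons : ∀ {n} (P : EdgePred n) f L →
  matchings P (f ∷ L) ≡ when (P f) (matchings (P ∧ᵖ disjointᵇ f) L) + matchings P L
matchings-cons P f L = begin
  count (isMatchingᵖ P) (map (f ∷_) (sublists L) ++ sublists L)
    ≡⟨ count-++ _ (map (f ∷_) (sublists L)) (sublists L) ⟩
  count (isMatchingᵖ P) (map (f ∷_) (sublists L)) + matchings P L
    ≡⟨ cong (_+ matchings P L) (count-map _ (f ∷_) (sublists L)) ⟩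
  count (λ M → P f ∧ all (disjointᵇ f) M ∧ isMatchingᵖ P M) (sublists L) + matchings P L
    ≡⟨ cong (_+ matchings P L) (through-f (P f)) ⟩
  when (P f) (matchings (P ∧ᵖ disjointᵇ f) L) + matchings P L ∎
  where
  open ≡-Reasoning
  through-f : ∀ b → count (λ M → b ∧ all (disjointᵇ f) M ∧ isMatchingᵖ P M) (sublists L)
                    ≡ when b (matchings (P ∧ᵖ disjointᵇ f) L)
  through-f true = count-cong (sublists L) (λ M → ≡.sym (isMatchingᵖ-∧ P (disjointᵇ f) M))
  through-f false = count-false (sublists L)

matchings-cong : ∀ {n} (P Q : EdgePred n) L → All (λ f → P f ≡ Q f) L →
  matchings P L ≡ matchings Q L
matchings-cong P Q [] _ = refl
matchings-cong P Q (f ∷ L) (Pf≡Qf ∷ P≡Q) rewrite matchings-cons P f L | matchings-cons Q f L | Pf≡Qf =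
  cong₂ _+_ (cong (when (Q f)) (matchings-cong _ _ L (All.map (cong (_∧ _)) P≡Q)))
            (matchings-cong P Q L P≡Q)

_⊆ᵖ_on_ : ∀ {n} → EdgePred n → EdgePred n → List (Pair n) → Set
P ⊆ᵖ Q on L = All (λ f → P f ≡ true → Q f ≡ true) L

⊆ᵖ-∧ : ∀ {n} {P Q : EdgePred n} R L → P ⊆ᵖ Q on L → (P ∧ᵖ R) ⊆ᵖ (Q ∧ᵖ R) on L
⊆ᵖ-∧ R L = All.map restrict
  where
  restrict : ∀ {a b c} → (a ≡ true → b ≡ true) → a ∧ c ≡ true → b ∧ c ≡ true
  restrict {true} a⇒b ac rewrite a⇒b refl = ac

when-mono : ∀ {a b : Bool} {x y} → (a ≡ true → b ≡ true) → x ≤ y → when a x ≤ when b y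
when-mono {false} _ _ = z≤n
when-mono {true} a⇒b x≤y rewrite a⇒b refl = x≤y

when-≤ : ∀ b x → when b x ≤ x
when-≤ true x = ≤-refl
when-≤ false x = z≤n

matchings-mono : ∀ {n} (P Q : EdgePred n) L → P ⊆ᵖ Q on L → matchings P L ≤ matchings Q L
matchings-mono P Q [] _ = ≤-refl
matchings-mono P Q (f ∷ L) (Pf⇒Qf ∷ P⊆Q) rewrite matchings-cons P f L | matchings-cons Q f L =
  +-mono-≤ (when-mono Pf⇒Qf (matchings-mono _ _ L (⊆ᵖ-∧ (disjointᵇ f) L P⊆Q)))
           (matchings-mono P Q L P⊆Q)

-- The empty matching always counts.
matchings-pos : ∀ {n} (P : EdgePred n) L → 1 ≤ matchings P L
matchings-pos P [] = ≤-refl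
matchings-pos P (f ∷ L) rewrite matchings-cons P f L = ≤-trans (matchings-pos P L) (m≤n+m _ _)

matchings-none : ∀ {n} (P : EdgePred n) L → All (λ f → P f ≡ false) L → matchings P L ≡ 1
matchings-none P [] _ = refl
matchings-none P (f ∷ L) (Pf ∷ noEdge) rewrite matchings-cons P f L | Pf = matchings-none P L noEdge

-- Adding a candidate edge e strictly increases the count (the matching {e}).
matchings-strict : ∀ {n} (P Q : EdgePred n) L → P ⊆ᵖ Q on L → (e : Pair n) → 1 ≤ count (samePair e) L →
  P e ≡ false → Q e ≡ true → matchings P L < matchings Q L
matchings-strict P Q [] _ e () Pe Qe
matchings-strict P Q (f ∷ L) (Pf⇒Qf ∷ P⊆Q) e e∈L Pe Qe with samePair e f in e≟f
... | true with refl ← samePair⇒≡ {e = e} e≟f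
  rewrite matchings-cons P e L | matchings-cons Q e L | Pe | Qe = begin-strict
    matchings P L                                      ≤⟨ matchings-mono P Q L P⊆Q ⟩
    matchings Q L                                      <⟨ m<n+m _ (matchings-pos _ L) ⟩
    matchings (Q ∧ᵖ disjointᵇ e) L + matchings Q L     ∎
  where open ≤-Reasoning
... | false rewrite matchings-cons P f L | matchings-cons Q f L =
  +-mono-≤-< (when-mono Pf⇒Qf (matchings-mono _ _ L (⊆ᵖ-∧ (disjointᵇ f) L P⊆Q)))
             (matchings-strict P Q L P⊆Q e e∈L Pe Qe)

matchings-skip : ∀ {n} (P : EdgePred n) f L → P f ≡ false → matchings P (f ∷ L) ≡ matchings P L
matchings-skip P f L Pf rewrite matchings-cons P f L | Pf = refl

disjointᵇ-self : ∀ {n} (e : Pair n) → disjointᵇ e e ≡ false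
disjointᵇ-self (a , b) rewrite ==-refl a = refl

disjointᵇ-sym : ∀ {n} (e f : Pair n) → disjointᵇ e f ≡ disjointᵇ f e
disjointᵇ-sym (a , b) (c , d) rewrite ==-sym c a | ==-sym c b | ==-sym d a | ==-sym d b =
  cong not (solve 4 (λ x y z w → x :+ (y :+ (z :+ w)) := x :+ (z :+ (y :+ w))) refl (a == c) (a == d) (b == c) (b == d))

matchings-absent : ∀ {n} (P : EdgePred n) e L → count (samePair e) L ≡ 0 →
  matchings P L ≡ matchings (P ─ e) L
matchings-absent P e L e∉L = matchings-cong _ _ L (All.map unaffected (count≡0 _ L e∉L))
  where
  unaffected : ∀ {f} → samePair e f ≡ false → P f ≡ (P ─ e) f
  unaffected {f} e≢f = ≡.sym (trans (cong (λ b → P f ∧ not b) e≢f) (∧-identityʳ _))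

interchange : ∀ a b c d → (a + b) + (c + d) ≡ (a + c) + (b + d)
interchange = solve-∀

split-rearrange : ∀ a b c A B C D →
  when a (C + when (b ∧ c) D) + (A + when b B) ≡ (when a C + A) + when b (when (a ∧ c) D + B)
split-rearrange true true true A B C D = interchange C D A B
split-rearrange true true false A B C D = interchange C 0 A B
split-rearrange true false c A B C D = interchange C 0 A 0
split-rearrange false true c A B C D = refl
split-rearrange false false c A B C D = refl

matchings-split : ∀ {n} (P : EdgePred n) e L → count (samePair e) L ≡ 1 →
  matchings P L ≡ matchings (P ─ e) L + when (P e) (matchings (P ∧ᵖ disjointᵇ e) L)
matchings-split P e [] ()
matchings-split {n} P e (f ∷ L) once with samePair e f in e≟f
... | true with refl ← samePair⇒≡ {e = e} e≟f = begin
    matchings P (e ∷ L)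
      ≡⟨ matchings-cons P e L ⟩
    when (P e) (matchings (P ∧ᵖ de) L) + matchings P L
      ≡⟨ +-comm _ (matchings P L) ⟩
    matchings P L + when (P e) (matchings (P ∧ᵖ de) L)
      ≡⟨ cong (_+ when (P e) (matchings (P ∧ᵖ de) L)) (matchings-absent P e L (suc-injective once)) ⟩
    matchings (P ─ e) L + when (P e) (matchings (P ∧ᵖ de) L)
      ≡⟨ cong₂ _+_ (matchings-skip (P ─ e) e L e∉P─e) (cong (when (P e)) (matchings-skip (P ∧ᵖ de) e L e∉P∧de)) ⟨
    matchings (P ─ e) (e ∷ L) + when (P e) (matchings (P ∧ᵖ de) (e ∷ L)) ∎
  where
  open ≡-Reasoning
  de = disjointᵇ e
  e∉P─e : (P ─ e) e ≡ false
  e∉P─e rewrite samePair-refl e = ∧-zeroʳ (P e)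
  e∉P∧de : (P ∧ᵖ de) e ≡ false
  e∉P∧de rewrite disjointᵇ-self e = ∧-zeroʳ (P e)
... | false = begin
    matchings P (f ∷ L)
      ≡⟨ matchings-cons P f L ⟩
    when (P f) (matchings (P ∧ᵖ df) L) + matchings P L
      ≡⟨ cong₂ _+_ (cong (when (P f)) (matchings-split (P ∧ᵖ df) e L once)) (matchings-split P e L once) ⟩
    when (P f) (matchings ((P ∧ᵖ df) ─ e) L + when (P e ∧ df e) (matchings ((P ∧ᵖ df) ∧ᵖ de) L))
      + (matchings (P ─ e) L + when (P e) (matchings (P ∧ᵖ de) L))
      ≡⟨ cong₂ (λ x y → when (P f) (x + y) + (matchings (P ─ e) L + when (P e) (matchings (P ∧ᵖ de) L)))
               (matchings-cong _ _ L (everywhere λ g → ∧-swapʳ (P g) (df g) (not (samePair e g))))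
               (cong₂ when (cong (P e ∧_) (disjointᵇ-sym f e))
                           (matchings-cong _ _ L (everywhere λ g → ∧-swapʳ (P g) (df g) (de g)))) ⟩
    when (P f) (matchings ((P ─ e) ∧ᵖ df) L + when (P e ∧ de f) (matchings ((P ∧ᵖ de) ∧ᵖ df) L))
      + (matchings (P ─ e) L + when (P e) (matchings (P ∧ᵖ de) L))
      ≡⟨ split-rearrange (P f) (P e) (de f) _ _ _ _ ⟩
    (when (P f) (matchings ((P ─ e) ∧ᵖ df) L) + matchings (P ─ e) L)
      + when (P e) (when (P f ∧ de f) (matchings ((P ∧ᵖ de) ∧ᵖ df) L) + matchings (P ∧ᵖ de) L)
      ≡⟨ cong (λ b → (when b (matchings ((P ─ e) ∧ᵖ df) L) + matchings (P ─ e) L)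
                     + when (P e) (when (P f ∧ de f) (matchings ((P ∧ᵖ de) ∧ᵖ df) L) + matchings (P ∧ᵖ de) L))
              f∈P─e ⟨
    (when ((P ─ e) f) (matchings ((P ─ e) ∧ᵖ df) L) + matchings (P ─ e) L)
      + when (P e) (when ((P ∧ᵖ de) f) (matchings ((P ∧ᵖ de) ∧ᵖ df) L) + matchings (P ∧ᵖ de) L)
      ≡⟨ cong₂ _+_ (matchings-cons (P ─ e) f L) (cong (when (P e)) (matchings-cons (P ∧ᵖ de) f L)) ⟨
    matchings (P ─ e) (f ∷ L) + when (P e) (matchings (P ∧ᵖ de) (f ∷ L)) ∎
  where
  open ≡-Reasoning
  df = disjointᵇ f
  de = disjointᵇ e
  f∈P─e : (P ─ e) f ≡ P f
  f∈P─e = trans (cong (λ b → P f ∧ not b) e≟f) (∧-identityʳ _)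
  ∧-swapʳ : ∀ a b c → (a ∧ b) ∧ c ≡ (a ∧ c) ∧ b
  ∧-swapʳ = solve 3 (λ a b c → (a :* b) :* c := (a :* c) :* b) refl
  everywhere : ∀ {Q R : EdgePred n} → (∀ g → Q g ≡ R g) → All (λ g → Q g ≡ R g) L
  everywhere Q≡R = All.tabulate (λ {g} _ → Q≡R g)

sum-single : ∀ {n} (g : Fin n → ℕ) (x₀ : Fin n) → (∀ x → x ≢ x₀ → g x ≡ 0) → sum g ≡ g x₀
sum-single {suc n} g zero others = trans (cong (g zero +_) (sum-zero (λ i → others (suc i) (λ ())))) (+-identityʳ _)
  where
  sum-zero : ∀ {m} {f : Fin m → ℕ} → (∀ i → f i ≡ 0) → sum f ≡ 0
  sum-zero {zero} _ = refl
  sum-zero {suc m} f≡0 rewrite f≡0 zero = sum-zero (λ i → f≡0 (suc i))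
sum-single {suc n} g (suc x₀) others rewrite others zero (λ ()) =
  sum-single (λ i → g (suc i)) x₀ (λ x x≢x₀ → others (suc x) (λ e → x≢x₀ (Fin.suc-injective e)))

<ᵇ-true : ∀ {m n} → m < n → (m <ᵇ n) ≡ true
<ᵇ-true {m} {n} m<n with m <ᵇ n in eq
... | true = refl
... | false = ⊥-elim (subst T eq (<⇒<ᵇ m<n))

pairBlock : ∀ {n} → Fin n → Fin n → List (Pair n)
pairBlock i j = if toℕ i <ᵇ toℕ j then (i , j) ∷ [] else []

-- Unfolding pairs n as a double sum over Fin n × Fin n, only the block (u , v) counts.
pairs-count : ∀ {n} (u v : Fin n) → toℕ u < toℕ v → count (samePair (u , v)) (pairs n) ≡ 1
pairs-count {n} u v u<v = begin
    count (samePair (u , v)) (pairs n)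
      ≡⟨ count-concatMap-tabulate (samePair (u , v)) (λ i → concatMap (pairBlock i) (allFin n)) (λ i → i) ⟩
    sum (λ i → count (samePair (u , v)) (concatMap (pairBlock i) (allFin n)))
      ≡⟨ sum-single _ u row-other ⟩
    count (samePair (u , v)) (concatMap (pairBlock u) (allFin n))
      ≡⟨ row u ⟩
    sum (λ j → count (samePair (u , v)) (pairBlock u j))
      ≡⟨ sum-single _ v (λ j j≢v → block-other u j (inj₂ j≢v)) ⟩
    count (samePair (u , v)) (pairBlock u v)
      ≡⟨ block-uv ⟩
    1 ∎
  where
  open ≡-Reasoning
  row : ∀ i → count (samePair (u , v)) (concatMap (pairBlock i) (allFin n))
              ≡ sum (λ j → count (samePair (u , v)) (pairBlock i j))
  row i = count-concatMap-tabulate _ (pairBlock i) (λ j → j)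
  block-other : ∀ i j → (i ≢ u) ⊎ (j ≢ v) → count (samePair (u , v)) (pairBlock i j) ≡ 0
  block-other i j other with toℕ i <ᵇ toℕ j
  ... | false = refl
  block-other i j (inj₁ i≢u) | true rewrite ≢⇒==false {i = u} (λ e → i≢u (≡.sym e)) = refl
  block-other i j (inj₂ j≢v) | true rewrite ≢⇒==false {i = v} (λ e → j≢v (≡.sym e)) | ∧-zeroʳ (u == i) = refl
  row-other : ∀ i → i ≢ u → count (samePair (u , v)) (concatMap (pairBlock i) (allFin n)) ≡ 0
  row-other i i≢u = begin
    count (samePair (u , v)) (concatMap (pairBlock i) (allFin n))  ≡⟨ row i ⟩
    sum (λ j → count (samePair (u , v)) (pairBlock i j))           ≡⟨ sum-single _ v (λ j j≢v → block-other i j (inj₂ j≢v)) ⟩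
    count (samePair (u , v)) (pairBlock i v)                       ≡⟨ block-other i v (inj₁ i≢u) ⟩
    0                                                              ∎
  block-uv : count (samePair (u , v)) (pairBlock u v) ≡ 1
  block-uv rewrite <ᵇ-true u<v | ==-refl u | ==-refl v = refl

pairs-ordered : ∀ n → All (λ e → toℕ (proj₁ e) < toℕ (proj₂ e)) (pairs n)
pairs-ordered n = concatMap⁺ (allFin n) (λ i → concatMap⁺ (allFin n) (block-ordered i))
  where
  concatMap⁺ : ∀ {A B : Set} {Q : B → Set} {f : A → List B} xs → (∀ x → All Q (f x)) → All Q (concatMap f xs)
  concatMap⁺ [] _ = []
  concatMap⁺ (x ∷ xs) h = ++⁺ (h x) (concatMap⁺ xs h)
  block-ordered : ∀ i j → All (λ e → toℕ (proj₁ e) < toℕ (proj₂ e)) (pairBlock i j)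
  block-ordered i j with toℕ i <ᵇ toℕ j in i<j
  ... | true = <ᵇ⇒< (toℕ i) (toℕ j) (subst T (≡.sym i<j) _) ∷ []
  ... | false = []

Sym : ∀ {n} → Adj n → Set
Sym {n} a = ∀ (i j : Fin n) → a i j ≡ a j i

Irrefl : ∀ {n} → Adj n → Set
Irrefl {n} a = ∀ (i : Fin n) → a i i ≡ false

_⊆ᵃ_ : ∀ {n} → Adj n → Adj n → Set
_⊆ᵃ_ {n} a b = ∀ (i j : Fin n) → toℕ i < toℕ j → a i j ≡ true → b i j ≡ true

edgesOf : ∀ {n} → Adj n → EdgePred n
edgesOf a e = a (proj₁ e) (proj₂ e)

deleteEdge : ∀ {n} → Fin n → Fin n → Adj n → Adj n
deleteEdge u v a i j = a i j ∧ not (memPair u v (i , j))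

deleteVertex : ∀ {n} → Fin n → Adj n → Adj n
deleteVertex x a i j = a i j ∧ not (i == x) ∧ not (j == x)

deleteVertices : ∀ {n} → Fin n → Fin n → Adj n → Adj n
deleteVertices u v a = deleteVertex u (deleteVertex v a)

deleteVertices-cong : ∀ {n} (p q : Fin n) (c c' : Adj n) →
  (∀ i j → (i == p) ≡ false → (j == p) ≡ false → (i == q) ≡ false → (j == q) ≡ false → c i j ≡ c' i j) →
  ∀ i j → deleteVertices p q c i j ≡ deleteVertices p q c' i j
deleteVertices-cong p q c c' agree i j with i == p in ip | j == p in jp | i == q in iq | j == q in jq
... | false | false | false | false = cong (λ z → (z ∧ true) ∧ true) (agree i j ip jp iq jq)
... | true | _ | _ | _ = trans (∧-zeroʳ _) (≡.sym (∧-zeroʳ _))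
... | false | true | _ | _ = trans (∧-zeroʳ _) (≡.sym (∧-zeroʳ _))
... | false | false | true | _ = cong (_∧ true) (trans (∧-zeroʳ (c i j)) (≡.sym (∧-zeroʳ (c' i j))))
... | false | false | false | true = cong (_∧ true) (trans (∧-zeroʳ (c i j)) (≡.sym (∧-zeroʳ (c' i j))))

deleteVertices-mono : ∀ {n} (p q : Fin n) (c c' : Adj n) i j → (c i j ≡ true → c' i j ≡ true) →
  deleteVertices p q c i j ≡ true → deleteVertices p q c' i j ≡ true
deleteVertices-mono p q c c' i j c⇒c' kept with c i j
... | true rewrite c⇒c' refl = kept
... | false with () ← kept

not-∨ : ∀ a b → not (a ∨ b) ≡ not a ∧ not b
not-∨ true b = refl
not-∨ false b = refl

memPair-sym : ∀ {n} (u v : Fin n) e → memPair u v e ≡ memPair v u e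
memPair-sym u v (i , j) = ∨-comm ((i == u) ∧ (j == v)) ((i == v) ∧ (j == u))

deleteVertices-sym : ∀ {n} (a : Adj n) u v i j → deleteVertices u v a i j ≡ deleteVertices v u a i j
deleteVertices-sym a u v i j =
  solve 5 (λ A p q r s → (A :* (r :* s)) :* (p :* q) := (A :* (p :* q)) :* (r :* s)) refl
    (a i j) (not (i == u)) (not (j == u)) (not (i == v)) (not (j == v))

disjoint-deleteVertices : ∀ {n} (a : Adj n) u v i j →
  (edgesOf a ∧ᵖ disjointᵇ (u , v)) (i , j) ≡ deleteVertices u v a i j
disjoint-deleteVertices a u v i j
  rewrite ==-sym u i | ==-sym u j | ==-sym v i | ==-sym v j
        | not-∨ (i == u) ((j == u) ∨ (i == v) ∨ (j == v)) | not-∨ (j == u) ((i == v) ∨ (j == v)) | not-∨ (i == v) (j == v) =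
  solve 5 (λ A p q r s → A :* (p :* (q :* (r :* s))) := (A :* (r :* s)) :* (p :* q)) refl
    (a i j) (not (i == u)) (not (j == u)) (not (i == v)) (not (j == v))

-- The Hosoya index of an adjacency function.  It is opaque: everything later
-- goes through the lemmas of the next block, which keeps unification from
-- unfolding the count of matchings.
opaque
  Zᵃ : ∀ {n} → Adj n → ℕ
  Zᵃ {n} a = matchings (edgesOf a) (pairs n)

opaque
  unfolding Zᵃ

  Z≡Zᵃ : ∀ {n} (G : Graph n) → Z G ≡ Zᵃ (adj G)
  Z≡Zᵃ {n} G = count-cong (sublists (pairs n)) same-test
    where
    same-test : ∀ M → isMatching G M ≡ isMatchingᵖ (edgesOf (adj G)) M
    same-test [] = refl
    same-test (e ∷ M) rewrite same-test M = refl

  on-pairs : ∀ {n} {Q : Pair n → Set} → (∀ i j → toℕ i < toℕ j → Q (i , j)) → All Q (pairs n)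
  on-pairs {n} h = All.map (λ {e} → h (proj₁ e) (proj₂ e)) (pairs-ordered n)

  Zᵃ-cong< : ∀ {n} (a b : Adj n) → (∀ i j → toℕ i < toℕ j → a i j ≡ b i j) → Zᵃ a ≡ Zᵃ b
  Zᵃ-cong< a b a≡b = matchings-cong _ _ _ (on-pairs a≡b)

  Zᵃ-mono : ∀ {n} (a b : Adj n) → a ⊆ᵃ b → Zᵃ a ≤ Zᵃ b
  Zᵃ-mono a b a⊆b = matchings-mono _ _ _ (on-pairs a⊆b)

  Zᵃ-empty : ∀ {n} (a : Adj n) → (∀ i j → toℕ i < toℕ j → a i j ≡ false) → Zᵃ a ≡ 1
  Zᵃ-empty a empty = matchings-none _ _ (on-pairs empty)

  Zᵃ-strict : ∀ {n} (a b : Adj n) → a ⊆ᵃ b →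
    ∀ i j → toℕ i < toℕ j → a i j ≡ false → b i j ≡ true → Zᵃ a < Zᵃ b
  Zᵃ-strict a b a⊆b i j i<j aij bij =
    matchings-strict _ _ _ (on-pairs a⊆b) (i , j) (≤-reflexive (≡.sym (pairs-count i j i<j))) aij bij

  Zᵃ-edge< : ∀ {n} (a : Adj n) (u v : Fin n) → toℕ u < toℕ v →
    Zᵃ a ≡ Zᵃ (deleteEdge u v a) + when (a u v) (Zᵃ (deleteVertices u v a))
  Zᵃ-edge< {n} a u v u<v =
    trans (matchings-split (edgesOf a) (u , v) (pairs n) (pairs-count u v u<v))
          (cong₂ _+_ (matchings-cong _ _ _ (on-pairs deleted))
                     (cong (when (a u v)) (matchings-cong _ _ _ (on-pairs (λ i j _ → disjoint-deleteVertices a u v i j)))))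
    where
    reversed : ∀ i j → toℕ i < toℕ j → ((i == v) ∧ (j == u)) ≡ false
    reversed i j i<j with i == v in iv | j == u in ju
    ... | false | _ = refl
    ... | true | false = refl
    ... | true | true with refl ← ==⇒≡ {i = i} iv | refl ← ==⇒≡ {i = j} ju = ⊥-elim (<-asym u<v i<j)
    deleted : ∀ i j → toℕ i < toℕ j → (edgesOf a ─ (u , v)) (i , j) ≡ deleteEdge u v a i j
    deleted i j i<j rewrite reversed i j i<j | ==-sym u i | ==-sym v j =
      cong (λ z → a i j ∧ not z) (≡.sym (∨-comm _ false))

Zᵃ-cong : ∀ {n} (a b : Adj n) → (∀ i j → a i j ≡ b i j) → Zᵃ a ≡ Zᵃ b
Zᵃ-cong a b a≡b = Zᵃ-cong< a b (λ i j _ → a≡b i j)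

Zᵃ-rigid : ∀ {n} (a b : Adj n) → a ⊆ᵃ b → Zᵃ a ≡ Zᵃ b → ∀ i j → toℕ i < toℕ j → a i j ≡ b i j
Zᵃ-rigid a b a⊆b Za≡Zb i j i<j with a i j in aij | b i j in bij
... | true | true = refl
... | false | false = refl
... | true | false = ⊥-elim (true≢false (trans (≡.sym (a⊆b i j i<j aij)) bij))
... | false | true = ⊥-elim (<-irrefl Za≡Zb (Zᵃ-strict a b a⊆b i j i<j aij bij))

Zᵃ-edge : ∀ {n} (a : Adj n) → Sym a → (x y : Fin n) → x ≢ y →
  Zᵃ a ≡ Zᵃ (deleteEdge x y a) + when (a x y) (Zᵃ (deleteVertices x y a))
Zᵃ-edge a sym x y x≢y with Fin.<-cmp x y
... | tri< x<y _ _ = Zᵃ-edge< a x y x<y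
... | tri≈ _ x≡y _ = ⊥-elim (x≢y x≡y)
... | tri> _ _ y<x = trans (Zᵃ-edge< a y x y<x)
  (cong₂ _+_ (Zᵃ-cong _ _ (λ i j → cong (λ z → a i j ∧ not z) (memPair-sym y x (i , j))))
             (cong₂ when (sym y x) (Zᵃ-cong _ _ (deleteVertices-sym a y x))))

-- Vertex recurrence: Z(a) = Z(a − x) + Σ_{y ~ x} Z(a − x − y).  It follows from
-- the edge recurrence applied to the edges xy one neighbour y at a time.

deleteStar : ∀ {n} → Fin n → List (Fin n) → Adj n → Adj n
deleteStar x Y a i j = a i j ∧ not (any (λ y → memPair x y (i , j)) Y)

any-false : ∀ {A : Set} (f : A → Bool) (Y : List A) → All (λ y → f y ≡ false) Y → any f Y ≡ false
any-false f [] [] = refl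
any-false f (y ∷ Y) (fy ∷ rest) rewrite fy = any-false f Y rest

any-tabulate : ∀ {A : Set} {n} (f : A → Bool) (g : Fin n → A) (i : Fin n) → f (g i) ≡ true →
  any f (tabulate g) ≡ true
any-tabulate f g zero fgi rewrite fgi = refl
any-tabulate f g (suc i) fgi with f (g zero)
... | true = refl
... | false = any-tabulate f (λ k → g (suc k)) i fgi

Sym-deleteStar : ∀ {n} (a : Adj n) x Y → Sym a → Sym (deleteStar x Y a)
Sym-deleteStar a x Y sym i j rewrite sym i j = cong (λ z → a j i ∧ not z) (flip Y)
  where
  flip : ∀ Y → any (λ y → memPair x y (i , j)) Y ≡ any (λ y → memPair x y (j , i)) Y
  flip [] = refl
  flip (y ∷ Y) = cong₂ _∨_ (solve 4 (λ p q r s → p :* q :+ r :* s := s :* r :+ q :* p) refl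
                                    (i == x) (j == y) (i == y) (j == x))
                           (flip Y)

vertexSum : ∀ {n} → Adj n → Fin n → List (Fin n) → ℕ
vertexSum a x Y = listSum (map (λ y → when (a x y) (Zᵃ (deleteVertices x y a))) Y)

Zᵃ-star-list : ∀ {n} (a : Adj n) → Sym a → Irrefl a → (x : Fin n) (Y : List (Fin n)) → Unique Y →
  Zᵃ a ≡ Zᵃ (deleteStar x Y a) + vertexSum a x Y
Zᵃ-star-list a sym irr x [] _ = trans (Zᵃ-cong _ _ (λ i j → ≡.sym (∧-identityʳ _))) (≡.sym (+-identityʳ _))
Zᵃ-star-list a sym irr x (y ∷ Y) (y∉Y ∷ unique) with y ≟ x
... | yes refl = begin
    Zᵃ a                                                        ≡⟨ Zᵃ-star-list a sym irr x Y unique ⟩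
    Zᵃ (deleteStar x Y a) + vertexSum a x Y                     ≡⟨ cong₂ _+_ (Zᵃ-cong< _ _ loop-free) (cong (λ z → when z (Zᵃ (deleteVertices x x a)) + vertexSum a x Y) (≡.sym (irr x))) ⟩
    Zᵃ (deleteStar x (x ∷ Y) a) + vertexSum a x (x ∷ Y)         ∎
  where
  open ≡-Reasoning
  -- the "edge" xx is never a candidate
  loop-free : ∀ i j → toℕ i < toℕ j → deleteStar x Y a i j ≡ deleteStar x (x ∷ Y) a i j
  loop-free i j i<j with i == x in ix | j == x in jx
  ... | false | _ = refl
  ... | true | false = refl
  ... | true | true with refl ← ==⇒≡ {i = i} ix | refl ← ==⇒≡ {i = j} jx = ⊥-elim (<-irrefl refl i<j)
... | no y≢x = begin
    Zᵃ a
      ≡⟨ Zᵃ-star-list a sym irr x Y unique ⟩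
    Zᵃ b + vertexSum a x Y
      ≡⟨ cong (_+ vertexSum a x Y) (Zᵃ-edge b (Sym-deleteStar a x Y sym) x y (λ e → y≢x (≡.sym e))) ⟩
    (Zᵃ (deleteEdge x y b) + when (b x y) (Zᵃ (deleteVertices x y b))) + vertexSum a x Y
      ≡⟨ cong₂ (λ p q → (p + q) + vertexSum a x Y) (Zᵃ-cong _ _ one-more)
               (cong₂ when xy-kept (Zᵃ-cong _ _ same-remainder)) ⟩
    (Zᵃ (deleteStar x (y ∷ Y) a) + when (a x y) (Zᵃ (deleteVertices x y a))) + vertexSum a x Y
      ≡⟨ +-assoc (Zᵃ (deleteStar x (y ∷ Y) a)) _ (vertexSum a x Y) ⟩
    Zᵃ (deleteStar x (y ∷ Y) a) + vertexSum a x (y ∷ Y) ∎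
  where
  open ≡-Reasoning
  b = deleteStar x Y a
  one-more : ∀ i j → deleteEdge x y b i j ≡ deleteStar x (y ∷ Y) a i j
  one-more i j rewrite not-∨ (memPair x y (i , j)) (any (λ y → memPair x y (i , j)) Y) =
    solve 3 (λ A p q → (A :* q) :* p := A :* (p :* q)) refl
      (a i j) (not (memPair x y (i , j))) (not (any (λ y → memPair x y (i , j)) Y))
  -- y ∉ Y, so xy is still an edge of b iff it is one of a
  xy-kept : b x y ≡ a x y
  xy-kept = trans (cong (λ z → a x y ∧ not z) (any-false _ Y (All.map other-pair y∉Y))) (∧-identityʳ _)
    where
    other-pair : ∀ {y'} → y ≢ y' → memPair x y' (x , y) ≡ false
    other-pair y≢y' rewrite ==-refl x | ≢⇒==false y≢y' | ≢⇒==false y≢x = ∧-zeroʳ _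
  off-x : ∀ {i j} → (i == x) ≡ false → (j == x) ≡ false → ∀ y' → memPair x y' (i , j) ≡ false
  off-x {i} ix jx y' rewrite ix | jx = ∧-zeroʳ (i == y')
  -- all edges deleted in b touch x, which deleteVertices removes anyway
  same-remainder : ∀ i j → deleteVertices x y b i j ≡ deleteVertices x y a i j
  same-remainder = deleteVertices-cong x y b a (λ i j ix jx _ _ →
    trans (cong (λ z → a i j ∧ not z) (any-false _ Y (All.tabulate (λ {y'} _ → off-x ix jx y')))) (∧-identityʳ _))

Zᵃ-star : ∀ {n} (a : Adj n) → Sym a → Irrefl a → (x : Fin n) →
  Zᵃ a ≡ Zᵃ (deleteVertex x a) + sum (λ y → when (a x y) (Zᵃ (deleteVertices x y a)))
Zᵃ-star {n} a sym irr x = trans (Zᵃ-star-list a sym irr x (allFin n) (allFin⁺ n))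
  (cong₂ _+_ (Zᵃ-cong _ _ all-edges-at-x) (listSum-allFin (λ y → when (a x y) (Zᵃ (deleteVertices x y a)))))
  where
  listSum-allFin : ∀ {m} (g : Fin m → ℕ) → listSum (map g (allFin m)) ≡ sum g
  listSum-allFin {m} g = trans (cong listSum (map-tabulate (λ i → i) g)) (tabulated g)
    where
    tabulated : ∀ {k} (h : Fin k → ℕ) → listSum (tabulate h) ≡ sum h
    tabulated {zero} h = refl
    tabulated {suc k} h = cong (h zero +_) (tabulated (λ i → h (suc i)))
  touches-x : ∀ i j → any (λ y → memPair x y (i , j)) (allFin n) ≡ ((i == x) ∨ (j == x))
  touches-x i j with i == x in ix
  ... | true = any-tabulate _ (λ k → k) j (cong (λ z → z ∨ ((i == j) ∧ (j == x))) (==-refl j))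
  ... | false with j == x in jx
  ... | true = any-tabulate _ (λ k → k) i (cong (λ z → z ∧ true) (==-refl i))
  ... | false = any-false _ (allFin n) (All.tabulate λ {y} _ → ∧-zeroʳ (i == y))
  all-edges-at-x : ∀ i j → deleteStar x (allFin n) a i j ≡ deleteVertex x a i j
  all-edges-at-x i j rewrite touches-x i j | not-∨ (i == x) (j == x) = refl

VSet : ℕ → Set
VSet n = Fin n → Bool

card : ∀ {n} → VSet n → ℕ
card A = sum (λ i → when (A i) 1)

_−ᵥ_ : ∀ {n} → VSet n → Fin n → VSet n
(A −ᵥ x) i = A i ∧ not (i == x)

card-cong : ∀ {n} (A B : VSet n) → (∀ i → A i ≡ B i) → card A ≡ card B
card-cong A B A≡B = sum-cong-≗ (λ i → cong (λ z → when z 1) (A≡B i))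

card-remove : ∀ {n} (A : VSet n) (x : Fin n) → card A ≡ card (A −ᵥ x) + when (A x) 1
card-remove {suc n} A zero rewrite ==-refl {suc n} zero | ∧-zeroʳ (A zero) =
  trans (+-comm (when (A zero) 1) _) (cong (_+ when (A zero) 1) (card-cong _ _ off-zero))
  where
  off-zero : ∀ i → A (suc i) ≡ (A −ᵥ zero) (suc i)
  off-zero i rewrite ≢⇒==false {i = suc i} {j = zero} (λ ()) = ≡.sym (∧-identityʳ _)
card-remove {suc n} A (suc x) rewrite ≢⇒==false {i = zero} {j = suc x} (λ ()) | ∧-identityʳ (A zero) =
  trans (cong (when (A zero) 1 +_) (trans (card-remove (λ i → A (suc i)) x) (cong (_+ when (A (suc x)) 1) (card-cong _ _ shifted))))
        (≡.sym (+-assoc (when (A zero) 1) _ _))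
  where
  shifted : ∀ i → A (suc i) ∧ not (i == x) ≡ A (suc i) ∧ not (suc i == suc x)
  shifted i rewrite ==-suc i x = refl

card-remove-member : ∀ {n} (A : VSet n) x → A x ≡ true → card A ≡ suc (card (A −ᵥ x))
card-remove-member A x Ax = trans (card-remove A x) (trans (cong (λ z → card (A −ᵥ x) + when z 1) Ax) (+-comm _ 1))

card-remove-nonmember : ∀ {n} (A : VSet n) x → A x ≡ false → card A ≡ card (A −ᵥ x)
card-remove-nonmember A x Ax = trans (card-remove A x) (trans (cong (λ z → card (A −ᵥ x) + when z 1) Ax) (+-identityʳ _))

find : ∀ {n} (A : VSet n) → (Σ (Fin n) λ x → A x ≡ true) ⊎ (∀ x → A x ≡ false)
find A with Fin.any? (λ i → A i ≟ᵇ true)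
... | yes member = inj₁ member
... | no none = inj₂ (λ x → ¬-not (λ Ax → none (x , Ax)))

card-empty : ∀ {n} (A : VSet n) → (∀ x → A x ≡ false) → card A ≡ 0
card-empty {zero} A _ = refl
card-empty {suc n} A empty rewrite empty zero = card-empty (λ i → A (suc i)) (λ i → empty (suc i))

card-pos : ∀ {n} (A : VSet n) x → A x ≡ true → 1 ≤ card A
card-pos A x Ax rewrite card-remove-member A x Ax = s≤s z≤n

card≡0 : ∀ {n} (A : VSet n) → card A ≡ 0 → ∀ x → A x ≡ false
card≡0 A empty x with A x in Ax
... | false = refl
... | true with () ← subst (1 ≤_) empty (card-pos A x Ax)

card≤1-singleton : ∀ {n} (A : VSet n) x → A x ≡ true → card A ≤ 1 → ∀ i → (i == x) ≡ false → A i ≡ false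
card≤1-singleton A x Ax |A|≤1 i i≢x =
  trans (≡.sym (∧-identityʳ (A i))) (trans (cong (λ z → A i ∧ not z) (≡.sym i≢x)) (card≡0 (A −ᵥ x) rest-empty i))
  where
  rest-empty : card (A −ᵥ x) ≡ 0
  rest-empty = n≤0⇒n≡0 (≤-pred (subst (_≤ 1) (card-remove-member A x Ax) |A|≤1))

card-full : ∀ n → card {n} (λ _ → true) ≡ n
card-full zero = refl
card-full (suc n) = cong suc (card-full n)

card-complement : ∀ {n} (A : VSet n) → card A + card (λ i → not (A i)) ≡ n
card-complement {zero} A = refl
card-complement {suc n} A with A zero
... | true = cong suc (card-complement (λ i → A (suc i)))
... | false = trans (+-suc _ _) (cong suc (card-complement (λ i → A (suc i))))

card-mono : ∀ {n} (A B : VSet n) → (∀ i → A i ≡ true → B i ≡ true) → card A ≤ card B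
card-mono {zero} A B _ = z≤n
card-mono {suc n} A B A⊆B with A zero in A0
... | true rewrite A⊆B zero A0 = s≤s (card-mono (λ i → A (suc i)) (λ i → B (suc i)) (λ i → A⊆B (suc i)))
... | false = ≤-trans (card-mono (λ i → A (suc i)) (λ i → B (suc i)) (λ i → A⊆B (suc i))) (m≤n+m _ (when (B zero) 1))

card-strict : ∀ {n} (A B : VSet n) → (∀ i → A i ≡ true → B i ≡ true) →
  (q : Fin n) → A q ≡ false → B q ≡ true → card A < card B
card-strict A B A⊆B q Aq Bq rewrite card-remove-nonmember A q Aq | card-remove-member B q Bq =
  s≤s (card-mono (A −ᵥ q) (B −ᵥ q) restricted)
  where
  restricted : ∀ i → (A −ᵥ q) i ≡ true → (B −ᵥ q) i ≡ true
  restricted i Ai with ∧-true {A i} Ai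
  ... | Ai , i≢q = trans (cong (_∧ not (i == q)) (A⊆B i Ai)) i≢q

card≤n : ∀ {n} (A : VSet n) → card A ≤ n
card≤n {n} A = subst (card A ≤_) (card-full n) (card-mono A (λ _ → true) (λ _ _ → refl))

card-permute : ∀ {n} (A : VSet n) (π : Fin n ↔ Fin n) → card (λ i → A (Inverse.to π i)) ≡ card A
card-permute A π = ≡.sym (sum-permute (λ i → when (A i) 1) π)

sum-when-const : ∀ {n} (p : VSet n) (f : Fin n → ℕ) (c : ℕ) → (∀ y → p y ≡ true → f y ≡ c) →
  sum (λ y → when (p y) (f y)) ≡ card p * c
sum-when-const {zero} p f c _ = refl
sum-when-const {suc n} p f c f≡c with p zero in p0
... | true = cong₂ _+_ (f≡c zero p0) (sum-when-const (λ i → p (suc i)) (λ i → f (suc i)) c (λ y → f≡c (suc y)))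
... | false = sum-when-const (λ i → p (suc i)) (λ i → f (suc i)) c (λ y → f≡c (suc y))

-- zK m = Z(K_m), the Hosoya index of the complete graph on m vertices:
-- Z(K_{m+2}) = Z(K_{m+1}) + (m+1)·Z(K_m) by the vertex recurrence.
zK : ℕ → ℕ
zK zero = 1
zK (suc zero) = 1
zK (suc (suc m)) = zK (suc m) + suc m * zK m

zK-pos : ∀ m → 1 ≤ zK m
zK-pos zero = ≤-refl
zK-pos (suc zero) = ≤-refl
zK-pos (suc (suc m)) = ≤-trans (zK-pos (suc m)) (m≤m+n _ _)

zK-mono : ∀ m → zK m ≤ zK (suc m)
zK-mono zero = ≤-refl
zK-mono (suc m) = m≤m+n _ _

zK-strict : ∀ m → zK (suc m) < zK (suc (suc m))
zK-strict m = m<m+n (zK (suc m)) (≤-trans (zK-pos m) (m≤m+n (zK m) (m * zK m)))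

zK-suc-≤ : ∀ m → zK (suc m) ≤ suc m * zK m
zK-suc-≤ zero = ≤-refl
zK-suc-≤ (suc m) = +-monoʳ-≤ (zK (suc m)) (*-monoʳ-≤ (suc m) (zK-mono m))

zK-product : ∀ a b → zK (suc a) * zK (suc b) ≤ zK (suc (a + b))
zK-product zero b = ≤-reflexive (+-identityʳ _)
zK-product (suc zero) b = begin
    (1 + 1 * 1) * zK (suc b)      ≡⟨ double (zK (suc b)) ⟩
    zK (suc b) + zK (suc b)       ≤⟨ +-monoʳ-≤ (zK (suc b)) (zK-suc-≤ b) ⟩
    zK (suc b) + suc b * zK b     ∎
  where
  open ≤-Reasoning
  double : ∀ z → (1 + 1 * 1) * z ≡ z + z
  double = solve-∀
zK-product (suc (suc c)) b = begin
    (zK (suc (suc c)) + suc (suc c) * zK (suc c)) * zK (suc b)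
      ≡⟨ distrib (zK (suc (suc c))) (suc (suc c)) (zK (suc c)) (zK (suc b)) ⟩
    zK (suc (suc c)) * zK (suc b) + suc (suc c) * (zK (suc c) * zK (suc b))
      ≤⟨ +-mono-≤ (zK-product (suc c) b) (*-monoʳ-≤ (suc (suc c)) (zK-product c b)) ⟩
    zK (suc (suc c + b)) + suc (suc c) * zK (suc (c + b))
      ≤⟨ +-monoʳ-≤ (zK (suc (suc c + b))) (*-monoˡ-≤ (zK (suc (c + b))) (s≤s (s≤s (m≤m+n c b)))) ⟩
    zK (suc (suc c + b)) + suc (suc (c + b)) * zK (suc (c + b)) ∎
  where
  open ≤-Reasoning
  distrib : ∀ p q r s → (p + q * r) * s ≡ p * s + q * (r * s)
  distrib = solve-∀

zK-product-strict : ∀ a b m → 1 ≤ a → 1 ≤ b → a + b ≡ m → zK a * zK b < zK m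
zK-product-strict (suc a) (suc b) m _ _ a+b≡m =
  subst (λ z → zK (suc a) * zK (suc b) < zK z) (trans (cong suc (≡.sym (+-suc a b))) a+b≡m)
        (≤-<-trans (zK-product a b) (zK-strict (a + b)))

zK-recurrence : ∀ a z → zK a * z + a * (zK (a ∸ 1) * z) ≡ zK (suc a) * z
zK-recurrence zero z = +-identityʳ _
zK-recurrence (suc c) z = regroup (zK (suc c)) (suc c) (zK c) z
  where
  regroup : ∀ p q r s → p * s + q * (r * s) ≡ (p + q * r) * s
  regroup = solve-∀

twoCliques : ∀ {n} → VSet n → VSet n → Adj n
twoCliques A B i j = ((A i ∧ A j) ∨ (B i ∧ B j)) ∧ not (i == j)

Disjoint : ∀ {n} → VSet n → VSet n → Set
Disjoint {n} A B = ∀ (i : Fin n) → A i ∧ B i ≡ false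

Disjoint-remove : ∀ {n} (A B : VSet n) x → Disjoint A B → Disjoint (A −ᵥ x) (B −ᵥ x)
Disjoint-remove A B x disj i with A i | B i | disj i
... | true | true | ()
... | true | false | _ = ∧-zeroʳ _
... | false | _ | _ = refl

member-not-other : ∀ {a b} → a ≡ true → a ∧ b ≡ false → b ≡ false
member-not-other refl ab = ab

twoCliques-sym : ∀ {n} (A B : VSet n) → Sym (twoCliques A B)
twoCliques-sym A B i j rewrite ∧-comm (A i) (A j) | ∧-comm (B i) (B j) | ==-sym i j = refl

twoCliques-irrefl : ∀ {n} (A B : VSet n) → Irrefl (twoCliques A B)
twoCliques-irrefl A B i rewrite ==-refl i = ∧-zeroʳ _

twoCliques-deleteVertex : ∀ {n} (A B : VSet n) x i j →
  deleteVertex x (twoCliques A B) i j ≡ twoCliques (A −ᵥ x) (B −ᵥ x) i j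
twoCliques-deleteVertex A B x i j =
  solve 7 (λ ai aj bi bj e p q → (((ai :* aj) :+ (bi :* bj)) :* e) :* (p :* q)
                                  := (((ai :* p) :* (aj :* q)) :+ ((bi :* p) :* (bj :* q))) :* e) refl
    (A i) (A j) (B i) (B j) (not (i == j)) (not (i == x)) (not (j == x))

twoCliques-deleteVertices : ∀ {n} (A B : VSet n) x y i j →
  deleteVertices x y (twoCliques A B) i j ≡ twoCliques ((A −ᵥ y) −ᵥ x) ((B −ᵥ y) −ᵥ x) i j
twoCliques-deleteVertices A B x y i j =
  trans (cong (λ z → z ∧ not (i == x) ∧ not (j == x)) (twoCliques-deleteVertex A B y i j))
        (twoCliques-deleteVertex (A −ᵥ y) (B −ᵥ y) x i j)

twoCliques-neighbours : ∀ {n} (A B : VSet n) x y → A x ≡ true → B x ≡ false →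
  twoCliques A B x y ≡ (A −ᵥ x) y
twoCliques-neighbours A B x y Ax Bx rewrite Ax | Bx | ==-sym x y = cong (_∧ not (y == x)) (∨-comm (A y) false)

TwoCliquesFormula : ∀ {n} → VSet n → VSet n → Set
TwoCliquesFormula A B = Zᵃ (twoCliques A B) ≡ zK (card A) * zK (card B)

-- Inductive step: expand at a vertex x ∈ A.  Deleting x leaves (A − x, B); each
-- of the |A| − 1 neighbours y leaves (A − x − y, B).
twoCliques-step : ∀ {n} N → (∀ (A B : VSet n) → Disjoint A B → card A + card B ≤ N → TwoCliquesFormula A B) →
  ∀ (A B : VSet n) → Disjoint A B → card A + card B ≤ suc N → (x : Fin n) → A x ≡ true →
  TwoCliquesFormula A B
twoCliques-step {n} N IH A B disj size x Ax = begin
    Zᵃ (twoCliques A B)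
      ≡⟨ Zᵃ-star (twoCliques A B) (twoCliques-sym A B) (twoCliques-irrefl A B) x ⟩
    Zᵃ (deleteVertex x (twoCliques A B)) + sum (λ y → when (twoCliques A B x y) (Zᵃ (deleteVertices x y (twoCliques A B))))
      ≡⟨ cong₂ _+_ without-x through-x ⟩
    zK a' * zK (card B) + a' * (zK (a' ∸ 1) * zK (card B))
      ≡⟨ zK-recurrence a' (zK (card B)) ⟩
    zK (suc a') * zK (card B)
      ≡⟨ cong (λ z → zK z * zK (card B)) (≡.sym |A|) ⟩
    zK (card A) * zK (card B) ∎
  where
  open ≡-Reasoning
  Bx = member-not-other Ax (disj x)
  a' = card (A −ᵥ x)
  |A| : card A ≡ suc a'
  |A| = card-remove-member A x Ax
  |B| : card B ≡ card (B −ᵥ x)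
  |B| = card-remove-nonmember B x Bx
  without-x : Zᵃ (deleteVertex x (twoCliques A B)) ≡ zK a' * zK (card B)
  without-x = trans (Zᵃ-cong _ _ (twoCliques-deleteVertex A B x))
    (trans (IH (A −ᵥ x) (B −ᵥ x) (Disjoint-remove A B x disj) (≤-pred (subst (_≤ suc N) (cong₂ _+_ |A| |B|) size)))
           (cong (λ z → zK a' * zK z) (≡.sym |B|)))
  edge-term : ∀ y → (A −ᵥ x) y ≡ true → Zᵃ (deleteVertices x y (twoCliques A B)) ≡ zK (a' ∸ 1) * zK (card B)
  edge-term y Ay-x = trans (Zᵃ-cong _ _ (twoCliques-deleteVertices A B x y))
      (trans (IH A'' B'' (Disjoint-remove (A −ᵥ y) (B −ᵥ y) x (Disjoint-remove A B y disj)) smaller)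
             (cong₂ (λ p q → zK p * zK q) (cong (_∸ 1) (suc-injective (trans (≡.sym |A''|) |A|))) (≡.sym |B''|)))
    where
    A'' = (A −ᵥ y) −ᵥ x
    B'' = (B −ᵥ y) −ᵥ x
    Ay = proj₁ (∧-true Ay-x)
    y≢x = proj₂ (∧-true {A y} Ay-x)
    |A''| : card A ≡ suc (suc (card A''))
    |A''| = trans (card-remove-member A y Ay)
      (cong suc (card-remove-member (A −ᵥ y) x (trans (cong (λ z → A x ∧ not z) (trans (==-sym x y) (not-true y≢x))) (trans (∧-identityʳ _) Ax))))
    |B''| : card B ≡ card B''
    |B''| = trans (card-remove-nonmember B y (member-not-other Ay (disj y)))
                  (card-remove-nonmember (B −ᵥ y) x (cong (_∧ not (x == y)) Bx))
    smaller : card A'' + card B'' ≤ N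
    smaller = ≤-trans (n≤1+n _) (≤-pred (subst (_≤ suc N) (cong₂ _+_ |A''| |B''|) size))
  through-x : sum (λ y → when (twoCliques A B x y) (Zᵃ (deleteVertices x y (twoCliques A B))))
              ≡ a' * (zK (a' ∸ 1) * zK (card B))
  through-x = trans (sum-cong-≗ (λ y → cong (λ z → when z (Zᵃ (deleteVertices x y (twoCliques A B))))
                                              (twoCliques-neighbours A B x y Ax Bx)))
                    (sum-when-const (A −ᵥ x) _ _ edge-term)

twoCliques-Z-bounded : ∀ {n} N (A B : VSet n) → Disjoint A B → card A + card B ≤ N → TwoCliquesFormula A B
twoCliques-Z-bounded zero A B _ size =
  trans (Zᵃ-empty (twoCliques A B) (λ i j _ → cong₂ (λ p q → ((p ∧ A j) ∨ (q ∧ B j)) ∧ not (i == j)) (card≡0 A |A|≡0 i) (card≡0 B |B|≡0 i)))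
        (≡.sym (cong₂ (λ p q → zK p * zK q) |A|≡0 |B|≡0))
  where
  |A|≡0 = n≤0⇒n≡0 (m+n≤o⇒m≤o (card A) size)
  |B|≡0 = n≤0⇒n≡0 (m+n≤o⇒n≤o (card A) size)
twoCliques-Z-bounded (suc N) A B disj size with find A | find B
... | inj₁ (x , Ax) | _ = twoCliques-step N (twoCliques-Z-bounded N) A B disj size x Ax
... | inj₂ _ | inj₁ (x , Bx) =
  trans (Zᵃ-cong _ _ (λ i j → cong (_∧ not (i == j)) (∨-comm (A i ∧ A j) (B i ∧ B j))))
        (trans (twoCliques-step N (twoCliques-Z-bounded N) B A (λ i → trans (∧-comm (B i) (A i)) (disj i))
                                (subst (_≤ suc N) (+-comm (card A) (card B)) size) x Bx)
               (*-comm (zK (card B)) _))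
... | inj₂ noA | inj₂ noB rewrite card-empty A noA | card-empty B noB =
  Zᵃ-empty (twoCliques A B) (λ i j _ → cong₂ (λ p q → ((p ∧ A j) ∨ (q ∧ B j)) ∧ not (i == j)) (noA i) (noB i))

twoCliques-Z : ∀ {n} (A B : VSet n) → Disjoint A B → TwoCliquesFormula A B
twoCliques-Z A B disj = twoCliques-Z-bounded _ A B disj ≤-refl

complete : ∀ {n} → Adj n
complete i j = not (i == j)

allV : ∀ {n} → VSet n
allV _ = true

noV : ∀ {n} → VSet n
noV _ = false

Disjoint-allV-noV : ∀ {n} → Disjoint (allV {n}) noV
Disjoint-allV-noV _ = refl

-- complete = twoCliques allV noV holds definitionally, so the two-cliques
-- formula applies to complete graphs minus vertices.
Z-complete-minus-one : ∀ m (x : Fin (suc m)) → Zᵃ (deleteVertex x complete) ≡ zK m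
Z-complete-minus-one m x = begin
    Zᵃ (deleteVertex x complete)
      ≡⟨ Zᵃ-cong (deleteVertex x complete) _ (twoCliques-deleteVertex allV noV x) ⟩
    Zᵃ (twoCliques (allV −ᵥ x) (noV −ᵥ x))
      ≡⟨ twoCliques-Z (allV −ᵥ x) (noV −ᵥ x) (Disjoint-remove allV noV x Disjoint-allV-noV) ⟩
    zK (card (allV −ᵥ x)) * zK (card (noV −ᵥ x))
      ≡⟨ cong₂ (λ p q → zK p * zK q) |allV−x| (card-empty (noV −ᵥ x) (λ _ → refl)) ⟩
    zK m * 1
      ≡⟨ *-identityʳ (zK m) ⟩
    zK m ∎
  where
  open ≡-Reasoning
  |allV−x| : card (allV −ᵥ x) ≡ m
  |allV−x| = suc-injective (trans (≡.sym (card-remove-member allV x refl)) (card-full (suc m)))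

Z-complete-minus-two : ∀ m (p q : Fin (suc (suc m))) → p ≢ q → Zᵃ (deleteVertices p q complete) ≡ zK m
Z-complete-minus-two m p q p≢q = begin
    Zᵃ (deleteVertices p q complete)
      ≡⟨ Zᵃ-cong (deleteVertices p q complete) _ (twoCliques-deleteVertices allV noV p q) ⟩
    Zᵃ (twoCliques ((allV −ᵥ q) −ᵥ p) ((noV −ᵥ q) −ᵥ p))
      ≡⟨ twoCliques-Z ((allV −ᵥ q) −ᵥ p) ((noV −ᵥ q) −ᵥ p) (Disjoint-remove (allV −ᵥ q) (noV −ᵥ q) p (Disjoint-remove allV noV q Disjoint-allV-noV)) ⟩
    zK (card ((allV −ᵥ q) −ᵥ p)) * zK (card ((noV −ᵥ q) −ᵥ p))
      ≡⟨ cong₂ (λ a b → zK a * zK b) |allV−q−p| (card-empty ((noV −ᵥ q) −ᵥ p) (λ _ → refl)) ⟩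
    zK m * 1
      ≡⟨ *-identityʳ (zK m) ⟩
    zK m ∎
  where
  open ≡-Reasoning
  |allV−q−p| : card ((allV −ᵥ q) −ᵥ p) ≡ m
  |allV−q−p| = suc-injective (suc-injective (begin
    suc (suc (card ((allV −ᵥ q) −ᵥ p)))
      ≡⟨ cong suc (card-remove-member (allV −ᵥ q) p (cong not (≢⇒==false p≢q))) ⟨
    suc (card (allV −ᵥ q))
      ≡⟨ card-remove-member allV q refl ⟨
    card (allV {suc (suc m)})
      ≡⟨ card-full (suc (suc m)) ⟩
    suc (suc m) ∎))

Z-minus-two-≤ : ∀ m (c : Adj (suc (suc m))) p q → p ≢ q → Zᵃ (deleteVertices p q c) ≤ zK m
Z-minus-two-≤ m c p q p≢q =
  ≤-trans (Zᵃ-mono (deleteVertices p q c) _ within-complete) (≤-reflexive (Z-complete-minus-two m p q p≢q))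
  where
  within-complete : deleteVertices p q c ⊆ᵃ deleteVertices p q complete
  within-complete i j i<j = deleteVertices-mono p q c complete i j
    (λ _ → cong not (≢⇒==false (λ i≡j → <-irrefl (cong toℕ i≡j) i<j)))

CompleteAwayFrom : ∀ {n} → Adj n → Fin n → Set
CompleteAwayFrom {n} a x = ∀ (i j : Fin n) → (i == x) ≡ false → (j == x) ≡ false → a i j ≡ complete i j

record Cone {n : ℕ} (a : Adj n) (x : Fin n) : Set where
  field
    symmetric : Sym a
    irreflexive : Irrefl a
    complete-off : CompleteAwayFrom a x

-- A clique K_{m+1} plus an apex x of degree d has Z = Z(K_{m+1}) + d·Z(K_m):
-- expand at x; deleting x leaves K_{m+1}, deleting x and a neighbour leaves K_m.
Zᵃ-cone : ∀ m (a : Adj (suc (suc m))) (x : Fin (suc (suc m))) → Cone a x →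
  Zᵃ a ≡ zK (suc m) + card (a x) * zK m
Zᵃ-cone m a x cone = begin
    Zᵃ a
      ≡⟨ Zᵃ-star a symmetric irreflexive x ⟩
    Zᵃ (deleteVertex x a) + sum (λ y → when (a x y) (Zᵃ (deleteVertices x y a)))
      ≡⟨ cong₂ _+_ (trans (Zᵃ-cong (deleteVertex x a) _ deleteVertex-x) (Z-complete-minus-one (suc m) x))
                   (sum-when-const (a x) _ _ through-y) ⟩
    zK (suc m) + card (a x) * zK m ∎
  where
  open ≡-Reasoning
  open Cone cone
  deleteVertex-x : ∀ i j → deleteVertex x a i j ≡ deleteVertex x complete i j
  deleteVertex-x i j with i == x in ix | j == x in jx
  ... | true | _ = trans (∧-zeroʳ _) (≡.sym (∧-zeroʳ _))
  ... | false | true = trans (∧-zeroʳ _) (≡.sym (∧-zeroʳ _))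
  ... | false | false = cong (_∧ true) (complete-off i j ix jx)
  through-y : ∀ y → a x y ≡ true → Zᵃ (deleteVertices x y a) ≡ zK m
  through-y y axy = trans (Zᵃ-cong (deleteVertices x y a) _ (deleteVertices-cong x y a complete (λ i j ix jx _ _ → complete-off i j ix jx)))
                          (Z-complete-minus-two m x y x≢y)
    where
    x≢y : x ≢ y
    x≢y refl = true≢false (trans (≡.sym axy) (irreflexive x))

card-below : ∀ p k → k ≤ p → card {p} (λ j → suc (toℕ j) ≤ᵇ k) ≡ k
card-below zero zero _ = refl
card-below (suc p) zero _ = card-empty {suc p} (λ j → suc (toℕ j) ≤ᵇ zero) (λ _ → refl)
card-below (suc p) (suc k) (s≤s k≤p) = cong suc (card-below p k k≤p)

degK : ∀ m k → k ≤ suc m → card {suc (suc m)} (adjK k zero) ≡ k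
degK m k k≤m+1 = card-below (suc m) k k≤m+1

K-cone : ∀ {n} k → Cone (adjK {suc n} k) zero
K-cone k = record { symmetric = adjK-sym k ; irreflexive = adjK-irrefl k ; complete-off = complete-off-0 }
  where
  complete-off-0 : CompleteAwayFrom (adjK k) zero
  complete-off-0 zero j () _
  complete-off-0 (suc i) zero _ ()
  complete-off-0 (suc i) (suc j) _ _ = cong not (≡.sym (==-suc i j))

Z-K : ∀ m k → k ≤ suc m → Z (K (suc (suc m)) k) ≡ zK (suc m) + k * zK m
Z-K m k k≤m+1 = begin
    Z (K (suc (suc m)) k)
      ≡⟨ Z≡Zᵃ (K (suc (suc m)) k) ⟩
    Zᵃ (adjK {suc (suc m)} k)
      ≡⟨ Zᵃ-cone m (adjK k) zero (K-cone k) ⟩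
    zK (suc m) + card (adjK {suc (suc m)} k zero) * zK m
      ≡⟨ cong (λ d → zK (suc m) + d * zK m) (degK m k k≤m+1) ⟩
    zK (suc m) + k * zK m ∎
  where open ≡-Reasoning

Reach-snoc : ∀ {n} {a : Adj n} {u p q} → Reach a u p → a p q ≡ true → Reach a u q
Reach-snoc here apq = step apq here
Reach-snoc (step e r) apq = step e (Reach-snoc r apq)

Reach-trans : ∀ {n} {a : Adj n} {u p q} → Reach a u p → Reach a p q → Reach a u q
Reach-trans here r = r
Reach-trans (step e r) r' = step e (Reach-trans r r')

Reach-sym : ∀ {n} {a : Adj n} → Sym a → ∀ {u p} → Reach a u p → Reach a p u
Reach-sym sym here = here
Reach-sym sym (step {u} {v} e r) = Reach-snoc (Reach-sym sym r) (trans (sym v u) e)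

any-witness : ∀ {n} (f : VSet n) → any f (allFin n) ≡ true → Σ (Fin n) λ p → f p ≡ true
any-witness {n} f some with find f
... | inj₁ witness = witness
... | inj₂ none with () ← trans (≡.sym some) (any-false f (allFin n) (All.tabulate (λ {p} _ → none p)))

-- The sequence grows until it
-- stabilises, which happens within n steps since each growth adds a vertex;
-- the limit is closed under the edges of d.
module Reachable {n : ℕ} (d : Adj n) (u : Fin n) where

  extend : VSet n → VSet n
  extend R q = R q ∨ any (λ p → R p ∧ d p q) (allFin n)

  within : ℕ → VSet n
  within zero q = q == u
  within (suc m) = extend (within m)

  within-suc : ∀ m q → within m q ≡ true → within (suc m) q ≡ true
  within-suc m q Rq rewrite Rq = refl

  within-sound : ∀ m q → within m q ≡ true → Reach d u q
  within-sound zero q q=u with refl ← ==⇒≡ {i = q} q=u = here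
  within-sound (suc m) q Rq with within m q in Rmq
  ... | true = within-sound m q Rmq
  ... | false with p , Rp∧dpq ← any-witness (λ p → within m p ∧ d p q) Rq =
    Reach-snoc (within-sound m p (proj₁ (∧-true Rp∧dpq))) (proj₂ (∧-true {within m p} Rp∧dpq))

  Stable : ℕ → Set
  Stable m = ∀ q → within (suc m) q ≡ within m q

  extend-cong : (R R' : VSet n) → (∀ q → R q ≡ R' q) → ∀ q → extend R q ≡ extend R' q
  extend-cong R R' R≡R' q = cong₂ _∨_ (R≡R' q) (along (allFin n))
    where
    along : ∀ ps → any (λ p → R p ∧ d p q) ps ≡ any (λ p → R' p ∧ d p q) ps
    along [] = refl
    along (p ∷ ps) = cong₂ _∨_ (cong (_∧ d p q) (R≡R' p)) (along ps)

  stable-forever : ∀ j → Stable j → ∀ k q → within (k + j) q ≡ within j q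
  stable-forever j st zero q = refl
  stable-forever j st (suc k) q = trans (extend-cong (within (k + j)) (within j) (stable-forever j st k) q) (st q)

  stable-or-grows : ∀ m → Stable m ⊎ (card (within m) < card (within (suc m)))
  stable-or-grows m with find (λ q → within (suc m) q ∧ not (within m q))
  ... | inj₁ (q , new) =
    inj₂ (card-strict (within m) (within (suc m)) (within-suc m) q (not-true (proj₂ (∧-true new))) (proj₁ (∧-true new)))
  ... | inj₂ nothing-new = inj₁ (λ q → same q (within m q) refl)
    where
    same : ∀ q b → within m q ≡ b → within (suc m) q ≡ within m q
    same q true Rq = trans (within-suc m q Rq) (≡.sym Rq)
    same q false Rq = begin
      within (suc m) q                        ≡⟨ ∧-identityʳ _ ⟨
      within (suc m) q ∧ not false            ≡⟨ cong (λ z → within (suc m) q ∧ not z) Rq ⟨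
      within (suc m) q ∧ not (within m q)     ≡⟨ nothing-new q ⟩
      false                                   ≡⟨ Rq ⟨
      within m q                              ∎
      where open ≡-Reasoning

  stabilises : ∀ m → (Σ ℕ λ j → (j ≤ m) × Stable j) ⊎ (suc m ≤ card (within m))
  stabilises zero = inj₂ (card-pos (within zero) u (==-refl u))
  stabilises (suc m) with stabilises m
  ... | inj₁ (j , j≤m , st) = inj₁ (j , m≤n⇒m≤1+n j≤m , st)
  ... | inj₂ big with stable-or-grows m
  ... | inj₁ st = inj₁ (m , n≤1+n m , st)
  ... | inj₂ grows = inj₂ (≤-trans (s≤s big) grows)

  closed : ∀ p q → within n p ≡ true → d p q ≡ true → within n q ≡ true
  closed p q Rp dpq with stabilises n
  ... | inj₂ too-big = ⊥-elim (<-irrefl refl (≤-trans too-big (card≤n (within n))))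
  ... | inj₁ (j , j≤n , st) = trans (≡.sym stable-at-n) reached-next
    where
    at-j : ∀ q → within n q ≡ within j q
    at-j q = trans (cong (λ z → within z q) (≡.sym (m∸n+n≡m j≤n))) (stable-forever j st (n ∸ j) q)
    stable-at-n : within (suc n) q ≡ within n q
    stable-at-n = trans (trans (extend-cong (within n) (within j) at-j q) (st q)) (≡.sym (at-j q))
    reached-next : within (suc n) q ≡ true
    reached-next with within n q
    ... | true = refl
    ... | false = any-tabulate (λ p' → within n p' ∧ d p' q) (λ k → k) p (trans (cong (_∧ d p q) Rp) dpq)

any-memPair-sym : ∀ {n} (i j : Fin n) F → any (memPair i j) F ≡ any (memPair j i) F
any-memPair-sym i j [] = refl
any-memPair-sym i j (f ∷ F) = cong₂ _∨_ (memPair-sym i j f) (any-memPair-sym i j F)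

Sym-deleteEdges : ∀ {n} (G : Graph n) F → Sym (deleteEdges G F)
Sym-deleteEdges G F p q = cong₂ (λ x y → x ∧ not y) (Graph.sym G p q) (any-memPair-sym p q F)

record Cut {n : ℕ} (G : Graph n) (F : List (Pair n)) : Set where
  field
    S : VSet n
    u v : Fin n
    Su : S u ≡ true
    Sv : S v ≡ false
    closed : ∀ p q → S p ≡ true → deleteEdges G F p q ≡ true → S q ≡ true

disconnected⇒cut : ∀ {m} (G : Graph (suc m)) F → (ConnectedAdj (deleteEdges G F) → ⊥) → Cut G F
disconnected⇒cut {m} G F disconnected with find (λ q → not (within (suc m) q))
  where open Reachable (deleteEdges G F) zero
... | inj₁ (v , unreached) = record
  { S = within (suc m) ; u = zero ; v = v ; Su = reaches-0 (suc m) ; Sv = not-true unreached ; closed = closed }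
  where
  open Reachable (deleteEdges G F) zero
  reaches-0 : ∀ k → within k zero ≡ true
  reaches-0 zero = ==-refl {suc m} zero
  reaches-0 (suc k) = within-suc k zero (reaches-0 k)
... | inj₂ all-reached = ⊥-elim (disconnected (λ p q →
  Reach-trans (Reach-sym (Sym-deleteEdges G F) (reached p)) (reached q)))
  where
  open Reachable (deleteEdges G F) zero
  reached : ∀ p → Reach (deleteEdges G F) zero p
  reached p = within-sound (suc m) p (not-false (all-reached p))

leaving-edge : ∀ {n} (G : Graph n) (S : VSet n) {x v} → Reach (adj G) x v → S x ≡ true → S v ≡ false →
  Σ (Fin n) λ p → Σ (Fin n) λ q → (S p ≡ true) × (S q ≡ false) × (adj G p q ≡ true)
leaving-edge G S here Sx Sv with () ← trans (≡.sym Sx) Sv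
leaving-edge G S (step {x} {y} e r) Sx Sv with S y in Sy
... | true = leaving-edge G S r Sy Sv
... | false = x , y , Sx , Sy , e

memPair⇒ : ∀ {n} (i j p q : Fin n) → memPair i j (p , q) ≡ true → ((p ≡ i) × (q ≡ j)) ⊎ ((p ≡ j) × (q ≡ i))
memPair⇒ i j p q h with (p == i) ∧ (q == j) in same
... | true = inj₁ (==⇒≡ (proj₁ (∧-true same)) , ==⇒≡ (proj₂ (∧-true {p == i} same)))
... | false = inj₂ (==⇒≡ (proj₁ (∧-true h)) , ==⇒≡ (proj₂ (∧-true {p == j} h)))

memPair-flip : ∀ {n} (p q i j : Fin n) → memPair p q (i , j) ≡ memPair i j (p , q)
memPair-flip p q i j rewrite ==-sym p i | ==-sym q j | ==-sym p j | ==-sym q i =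
  cong ((i == p) ∧ (j == q) ∨_) (∧-comm (i == q) (j == p))

-- Adding the crossing pairs one at a time costs at most Z(K_m)
-- each (cover-bound), and strictly less when both sides have two or more
-- vertices (cover-bound-strict).
module CutCover (m : ℕ) (S : VSet (suc (suc m))) where

  Sᶜ : VSet (suc (suc m))
  Sᶜ i = not (S i)

  base : Adj (suc (suc m))
  base = twoCliques S Sᶜ

  crossing : Adj (suc (suc m))
  crossing i j = S i xor S j

  cover : List (Pair (suc (suc m))) → Adj (suc (suc m))
  cover F i j = base i j ∨ (crossing i j ∧ any (memPair i j) F)

  crosses : List (Pair (suc (suc m))) → Bool
  crosses F = any (λ f → crossing (proj₁ f) (proj₂ f)) F

  crossing-sym : Sym crossing
  crossing-sym i j with S i | S j
  ... | true | true = refl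
  ... | true | false = refl
  ... | false | true = refl
  ... | false | false = refl

  crossing-irrefl : Irrefl crossing
  crossing-irrefl i with S i
  ... | true = refl
  ... | false = refl

  Disjoint-S-Sᶜ : Disjoint S Sᶜ
  Disjoint-S-Sᶜ i with S i
  ... | true = refl
  ... | false = refl

  cover-sym : ∀ F → Sym (cover F)
  cover-sym F i j = cong₂ _∨_ (twoCliques-sym S Sᶜ i j) (cong₂ _∧_ (crossing-sym i j) (any-memPair-sym i j F))

  cover-irrefl : ∀ F → Irrefl (cover F)
  cover-irrefl F i rewrite twoCliques-irrefl S Sᶜ i | crossing-irrefl i = refl

  cover-same-side : ∀ F i j → S i ≡ S j → cover F i j ≡ complete i j
  cover-same-side F i j same with S i | S j | same
  ... | true | true | _ = ∨-comm _ false
  ... | false | false | _ = ∨-comm _ false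

  crosses-intro : ∀ i j F → crossing i j ≡ true → any (memPair i j) F ≡ true → crosses F ≡ true
  crosses-intro i j ((p , q) ∷ F) ij-crosses ij∈F with memPair i j (p , q) in ij≡pq
  ... | true with memPair⇒ i j p q ij≡pq
  ... | inj₁ (refl , refl) rewrite ij-crosses = refl
  ... | inj₂ (refl , refl) rewrite trans (crossing-sym j i) ij-crosses = refl
  crosses-intro i j ((p , q) ∷ F) ij-crosses ij∈F | false
    rewrite crosses-intro i j F ij-crosses ij∈F = ∨-comm _ true

  cover-base : ∀ F → crosses F ≡ false → ∀ i j → cover F i j ≡ base i j
  cover-base F none i j with crossing i j in ij-crosses | any (memPair i j) F in ij∈F
  ... | false | _ = ∨-comm _ false
  ... | true | false = ∨-comm _ false
  ... | true | true with () ← trans (≡.sym none) (crosses-intro i j F ij-crosses ij∈F)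

  cover-delete-head : ∀ p q F → deleteEdge p q (cover ((p , q) ∷ F)) ⊆ᵃ cover F
  cover-delete-head p q F i j _ h =
    drop-deleted (base i j) (crossing i j) (memPair i j (p , q)) (any (memPair i j) F)
      (subst (λ z → (base i j ∨ (crossing i j ∧ (memPair i j (p , q) ∨ any (memPair i j) F))) ∧ not z ≡ true)
             (memPair-flip p q i j) h)
    where
    drop-deleted : ∀ b x M A → (b ∨ (x ∧ (M ∨ A))) ∧ not M ≡ true → b ∨ (x ∧ A) ≡ true
    drop-deleted true x M A _ = refl
    drop-deleted false true false A h = trans (≡.sym (∧-identityʳ A)) h

  cover-skip-head : ∀ p q F → crossing p q ≡ false → ∀ i j → cover ((p , q) ∷ F) i j ≡ cover F i j
  cover-skip-head p q F pq-inside i j with crossing i j in ij-crosses | memPair i j (p , q) in ij≡pq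
  ... | false | _ = refl
  ... | true | false = refl
  ... | true | true with memPair⇒ i j p q ij≡pq
  ... | inj₁ (refl , refl) with () ← trans (≡.sym ij-crosses) pq-inside
  ... | inj₂ (refl , refl) with () ← trans (≡.sym ij-crosses) (trans (crossing-sym i j) pq-inside)

  crossing⇒≢ : ∀ p q → crossing p q ≡ true → p ≢ q
  crossing⇒≢ p .p pq-crosses refl = true≢false (trans (≡.sym pq-crosses) (crossing-irrefl p))

  cover-edge : ∀ p q F → crossing p q ≡ true →
    Zᵃ (cover ((p , q) ∷ F)) ≤ Zᵃ (cover F) + Zᵃ (deleteVertices p q (cover ((p , q) ∷ F)))
  cover-edge p q F pq-crosses = begin
    Zᵃ (cover ((p , q) ∷ F))
      ≡⟨ Zᵃ-edge (cover ((p , q) ∷ F)) (cover-sym ((p , q) ∷ F)) p q (crossing⇒≢ p q pq-crosses) ⟩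
    Zᵃ (deleteEdge p q (cover ((p , q) ∷ F))) + when _ (Zᵃ (deleteVertices p q (cover ((p , q) ∷ F))))
      ≤⟨ +-mono-≤ (Zᵃ-mono _ _ (cover-delete-head p q F)) (when-≤ _ _) ⟩
    Zᵃ (cover F) + Zᵃ (deleteVertices p q (cover ((p , q) ∷ F))) ∎
    where open ≤-Reasoning

  cover-step : ∀ p q F → Zᵃ (cover ((p , q) ∷ F)) ≤ Zᵃ (cover F) + zK m
  cover-step p q F with crossing p q in pq-crosses
  ... | true = ≤-trans (cover-edge p q F pq-crosses)
                       (+-monoʳ-≤ (Zᵃ (cover F)) (Z-minus-two-≤ m (cover ((p , q) ∷ F)) p q (crossing⇒≢ p q pq-crosses)))
  ... | false = ≤-trans (≤-reflexive (Zᵃ-cong _ _ (cover-skip-head p q F pq-crosses))) (m≤m+n _ _)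

  one-more-pair : ∀ a l z → a + l * z + z ≡ a + suc l * z
  one-more-pair = solve-∀

  swap-last : ∀ a b c → a + b + c ≡ a + c + b
  swap-last = solve-∀

  cover-bound : ∀ F → Zᵃ (cover F) ≤ Zᵃ base + length F * zK m
  cover-bound [] = ≤-reflexive (trans (Zᵃ-cong _ _ (cover-base [] refl)) (≡.sym (+-identityʳ _)))
  cover-bound ((p , q) ∷ F) = begin
    Zᵃ (cover ((p , q) ∷ F))              ≤⟨ cover-step p q F ⟩
    Zᵃ (cover F) + zK m                   ≤⟨ +-monoˡ-≤ (zK m) (cover-bound F) ⟩
    Zᵃ base + length F * zK m + zK m      ≡⟨ one-more-pair (Zᵃ base) (length F) (zK m) ⟩
    Zᵃ base + suc (length F) * zK m       ∎
    where open ≤-Reasoning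

  module Strict (below : ∀ p q → crossing p q ≡ true → Zᵃ (deleteVertices p q base) < zK m) where

    -- the contraction at the first crossing pair only sees K_S ∪ K_Sᶜ
    first-crossing : ∀ p q F → crosses F ≡ false → ∀ i j → (i == p) ≡ false → (j == p) ≡ false →
      (i == q) ≡ false → (j == q) ≡ false → cover ((p , q) ∷ F) i j ≡ base i j
    first-crossing p q F none i j ip jp iq jq rewrite ==-sym p i | ip | ==-sym p j | jp = cover-base F none i j

    cover-bound-strict : ∀ F → Zᵃ (cover F) + when (crosses F) 1 ≤ Zᵃ base + length F * zK m
    cover-bound-strict [] = ≤-reflexive (trans (+-identityʳ _) (trans (Zᵃ-cong _ _ (cover-base [] refl)) (≡.sym (+-identityʳ _))))
    cover-bound-strict ((p , q) ∷ F) with crosses F in F-crosses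
    ... | true = begin
        Zᵃ (cover ((p , q) ∷ F)) + when (crossing p q ∨ true) 1
          ≡⟨ cong (λ z → Zᵃ (cover ((p , q) ∷ F)) + when z 1) (∨-comm _ true) ⟩
        Zᵃ (cover ((p , q) ∷ F)) + 1
          ≤⟨ +-monoˡ-≤ 1 (cover-step p q F) ⟩
        Zᵃ (cover F) + zK m + 1
          ≡⟨ swap-last (Zᵃ (cover F)) (zK m) 1 ⟩
        Zᵃ (cover F) + 1 + zK m
          ≤⟨ +-monoˡ-≤ (zK m) (subst (λ z → Zᵃ (cover F) + when z 1 ≤ Zᵃ base + length F * zK m) F-crosses (cover-bound-strict F)) ⟩
        Zᵃ base + length F * zK m + zK m
          ≡⟨ one-more-pair (Zᵃ base) (length F) (zK m) ⟩
        Zᵃ base + suc (length F) * zK m ∎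
      where open ≤-Reasoning
    ... | false with crossing p q in pq-crosses
    ... | false = ≤-trans (≤-reflexive (+-identityʳ _)) (cover-bound ((p , q) ∷ F))
    ... | true = begin
        Zᵃ (cover ((p , q) ∷ F)) + 1
          ≤⟨ +-monoˡ-≤ 1 (cover-edge p q F pq-crosses) ⟩
        Zᵃ (cover F) + Zᵃ (deleteVertices p q (cover ((p , q) ∷ F))) + 1
          ≡⟨ cong₂ (λ x y → x + y + 1) (Zᵃ-cong _ _ (cover-base F F-crosses))
                   (Zᵃ-cong _ _ (deleteVertices-cong p q _ _ (first-crossing p q F F-crosses))) ⟩
        Zᵃ base + Zᵃ (deleteVertices p q base) + 1
          ≡⟨ +-assoc (Zᵃ base) _ 1 ⟩
        Zᵃ base + (Zᵃ (deleteVertices p q base) + 1)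
          ≤⟨ +-monoʳ-≤ (Zᵃ base) (subst (_≤ zK m) (+-comm 1 _) (below p q pq-crosses)) ⟩
        Zᵃ base + zK m
          ≤⟨ +-monoʳ-≤ (Zᵃ base) (m≤m+n (zK m) _) ⟩
        Zᵃ base + suc (length F) * zK m ∎
      where open ≤-Reasoning

-- Relabelling: a cone over K_{n-1} whose apex has degree k is a relabelling of
-- K^k_{n-1,1}.  Transpositions move the apex to 0 and then, one at a time, move
-- the apex's neighbours onto 1..k.

permute : ∀ {n} → Fin n ↔ Fin n → Adj n → Adj n
permute π a u v = a (Inverse.to π u) (Inverse.to π v)

RelabelsK : ∀ {n} → ℕ → Adj n → Set
RelabelsK {n} k a = Σ (Fin n ↔ Fin n) λ σ → ∀ u v → a u v ≡ adjK k (Inverse.to σ u) (Inverse.to σ v)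

relabels-permute : ∀ {n} k (a : Adj n) (π : Fin n ↔ Fin n) → RelabelsK k (permute π a) → RelabelsK k a
relabels-permute k a π (ρ , permuted≡K) = ρ ↔-∘ ↔-sym π , λ u v →
  trans (cong₂ a (≡.sym (Inverse.strictlyInverseˡ π u)) (≡.sym (Inverse.strictlyInverseˡ π v)))
        (permuted≡K (Inverse.from π u) (Inverse.from π v))

to-injective : ∀ {n} (π : Fin n ↔ Fin n) u v → Inverse.to π u ≡ Inverse.to π v → u ≡ v
to-injective π u v πu≡πv =
  trans (≡.sym (Inverse.strictlyInverseʳ π u)) (trans (cong (Inverse.from π) πu≡πv) (Inverse.strictlyInverseʳ π v))

complete-permute : ∀ {n} (π : Fin n ↔ Fin n) (a : Adj n) x →
  CompleteAwayFrom a (Inverse.to π x) → CompleteAwayFrom (permute π a) x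
complete-permute π a x complete i j ix jx =
  trans (complete (Inverse.to π i) (Inverse.to π j) (moved ix) (moved jx))
        (cong not (==-injective (Inverse.to π) (to-injective π) i j))
  where
  moved : ∀ {i} → (i == x) ≡ false → (Inverse.to π i == Inverse.to π x) ≡ false
  moved ix = ≢⇒==false (λ e → ==false⇒≢ ix (to-injective π _ _ e))

cone-permute : ∀ {n} (π : Fin n ↔ Fin n) (a : Adj n) x → Cone a (Inverse.to π x) → Cone (permute π a) x
cone-permute π a x cone = record
  { symmetric = λ u v → symmetric (Inverse.to π u) (Inverse.to π v)
  ; irreflexive = λ u → irreflexive (Inverse.to π u)
  ; complete-off = complete-permute π a x complete-off }
  where open Cone cone

degree-permute : ∀ {n} (π : Fin n ↔ Fin n) (a : Adj n) x → card (permute π a x) ≡ card (a (Inverse.to π x))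
degree-permute π a x = card-permute (a (Inverse.to π x)) π

transpose-left : ∀ {n} (i j : Fin n) → Inverse.to (transpose i j) i ≡ j
transpose-left i j rewrite dec-true (i ≟ i) refl = refl

transpose-right : ∀ {n} (i j : Fin n) → Inverse.to (transpose i j) j ≡ i
transpose-right i j with j ≟ i
... | yes refl = refl
... | no j≢i rewrite dec-true (j ≟ j) refl = refl

transpose-other : ∀ {n} (i j k : Fin n) → k ≢ i → k ≢ j → Inverse.to (transpose i j) k ≡ k
transpose-other i j k k≢i k≢j rewrite dec-false (k ≟ i) k≢i | dec-false (k ≟ j) k≢j = refl

card-⊆-eq : ∀ {n} (A B : VSet n) → (∀ i → A i ≡ true → B i ≡ true) → card A ≡ card B →
  ∀ i → B i ≡ true → A i ≡ true
card-⊆-eq A B A⊆B |A|≡|B| i Bi with A i in Ai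
... | true = refl
... | false = ⊥-elim (<-irrefl |A|≡|B| (card-strict A B A⊆B i Ai Bi))

missing : ∀ {n} → ℕ → Adj (suc n) → VSet (suc n)
missing k a j = adjK k zero j ∧ not (a zero j)

cone-at-0-is-K : ∀ {n} k (a : Adj (suc n)) → Cone a zero → (∀ j → a zero j ≡ adjK k zero j) → ∀ u v → a u v ≡ adjK k u v
cone-at-0-is-K k a cone apex zero v = apex v
cone-at-0-is-K k a cone apex (suc u) zero = trans (Cone.symmetric cone (suc u) zero) (apex (suc u))
cone-at-0-is-K k a cone apex (suc u) (suc v) =
  trans (Cone.complete-off cone (suc u) (suc v) (≢⇒==false {i = suc u} {j = zero} (λ ())) (≢⇒==false {i = suc v} {j = zero} (λ ())))
        (cong not (==-suc u v))

-- Transposing a missing K-neighbour j with a surplus neighbour y of the apex 0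
-- repairs j and changes nothing else.
missing-after-swap : ∀ {n} k (a : Adj (suc n)) j y → missing k a j ≡ true → a zero y ∧ not (adjK k zero y) ≡ true →
  Inverse.to (transpose j y) zero ≡ zero → card (missing k a) ≡ suc (card (missing k (permute (transpose j y) a)))
missing-after-swap k a j y j-missing y-extra τ0 = begin
    card (missing k a)                        ≡⟨ card-remove-member (missing k a) j j-missing ⟩
    suc (card (missing k a −ᵥ j))             ≡⟨ cong suc (card-cong _ _ unchanged) ⟩
    suc (card (missing k a' −ᵥ j))            ≡⟨ cong suc (card-remove-nonmember (missing k a') j j-repaired) ⟨
    suc (card (missing k a'))                 ∎
  where
  open ≡-Reasoning
  τ = transpose j y
  a' = permute τ a
  y-notK : adjK k zero y ≡ false
  y-notK = not-true (proj₂ (∧-true {a zero y} y-extra))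
  j-repaired : missing k a' j ≡ false
  j-repaired rewrite τ0 | transpose-left j y | proj₁ (∧-true {a zero y} y-extra) = ∧-zeroʳ _
  unchanged : ∀ i → (missing k a −ᵥ j) i ≡ (missing k a' −ᵥ j) i
  unchanged i = by-cases (i ≟ j) (i ≟ y)
    where
    by-cases : Dec (i ≡ j) → Dec (i ≡ y) → (missing k a −ᵥ j) i ≡ (missing k a' −ᵥ j) i
    by-cases (yes refl) _ rewrite ==-refl i = trans (∧-zeroʳ _) (≡.sym (∧-zeroʳ _))
    by-cases (no _) (yes refl) rewrite y-notK = refl
    by-cases (no i≢j) (no i≢y) rewrite τ0 | transpose-other j y i i≢j i≢y = refl

cone-at-0-relabels : ∀ m k → k ≤ suc m → ∀ d (a : Adj (suc (suc m))) → Cone a zero → card (a zero) ≡ k →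
  card (missing k a) ≡ d → RelabelsK k a
cone-at-0-relabels m k k≤m+1 zero a cone deg none-missing = ↔-id _ , cone-at-0-is-K k a cone apex
  where
  K⊆a : ∀ j → adjK k zero j ≡ true → a zero j ≡ true
  K⊆a j Kj = not-false (trans (cong (λ z → z ∧ not (a zero j)) (≡.sym Kj)) (card≡0 (missing k a) none-missing j))
  apex : ∀ j → a zero j ≡ adjK k zero j
  apex j with adjK k zero j in Kj | a zero j in aj
  ... | true | _ = trans (≡.sym aj) (K⊆a j Kj)
  ... | false | false = refl
  ... | false | true with () ← trans (≡.sym (card-⊆-eq (adjK k zero) (a zero) K⊆a (trans (degK m k k≤m+1) (≡.sym deg)) j aj)) Kj
cone-at-0-relabels m k k≤m+1 (suc d) a cone deg d-missing with find (missing k a)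
... | inj₂ none = ⊥-elim (0≢1+n (trans (≡.sym (card-empty _ none)) d-missing))
... | inj₁ (j , j-missing) with find (λ y → a zero y ∧ not (adjK k zero y))
... | inj₂ no-extra = ⊥-elim (true≢false (trans (≡.sym (card-⊆-eq (a zero) (adjK k zero) a⊆K (trans deg (≡.sym (degK m k k≤m+1))) j Kj))
                                               (not-true (proj₂ (∧-true j-missing)))))
  where
  Kj = proj₁ (∧-true j-missing)
  a⊆K : ∀ i → a zero i ≡ true → adjK k zero i ≡ true
  a⊆K i ai = not-false (trans (cong (λ z → z ∧ not (adjK k zero i)) (≡.sym ai)) (no-extra i))
... | inj₁ (y , y-extra) = relabels-permute k a τ (cone-at-0-relabels m k k≤m+1 d (permute τ a)
      (cone-permute τ a zero (subst (Cone a) (≡.sym τ0) cone))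
      (trans (degree-permute τ a zero) (trans (cong (λ z → card (a z)) τ0) deg))
      (suc-injective (trans (≡.sym (missing-after-swap k a j y j-missing y-extra τ0)) d-missing)))
  where
  τ = transpose j y
  j≢0 : j ≢ zero
  j≢0 refl with () ← proj₁ (∧-true {b = not (a zero zero)} j-missing)
  y≢0 : y ≢ zero
  y≢0 refl = true≢false (trans (≡.sym (proj₁ (∧-true {a zero y} y-extra))) (Cone.irreflexive cone zero))
  τ0 : Inverse.to τ zero ≡ zero
  τ0 = transpose-other j y zero (λ e → j≢0 (≡.sym e)) (λ e → y≢0 (≡.sym e))

cone-relabels : ∀ m k → k ≤ suc m → (a : Adj (suc (suc m))) (x : Fin (suc (suc m))) → Cone a x → card (a x) ≡ k →
  RelabelsK k a
cone-relabels m k k≤m+1 a x cone deg = relabels-permute k a π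
  (cone-at-0-relabels m k k≤m+1 _ (permute π a) (cone-permute π a zero (subst (Cone a) (≡.sym πx) cone))
     (trans (degree-permute π a zero) (trans (cong (λ z → card (a z)) πx) deg)) refl)
  where
  π = transpose zero x
  πx : Inverse.to π zero ≡ x
  πx = transpose-left zero x

-- Conversely, a relabelling of K^k_{n-1,1} is a cone with apex σ⁻¹(0) of degree k,
-- so it has the same Hosoya index.
relabel-Z : ∀ m k → k ≤ suc m → (G : Graph (suc (suc m))) → G ≅ K (suc (suc m)) k → Z G ≡ Z (K (suc (suc m)) k)
relabel-Z m k k≤m+1 G (σ , G≡σK) = begin
    Z G                                    ≡⟨ Z≡Zᵃ G ⟩
    Zᵃ (adj G)                             ≡⟨ Zᵃ-cone m (adj G) x cone ⟩
    zK (suc m) + card (adj G x) * zK m     ≡⟨ cong (λ d → zK (suc m) + d * zK m) degree ⟩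
    zK (suc m) + k * zK m                  ≡⟨ Z-K m k k≤m+1 ⟨
    Z (K (suc (suc m)) k)                  ∎
  where
  open ≡-Reasoning
  x = Inverse.from σ zero
  σx : Inverse.to σ x ≡ zero
  σx = Inverse.strictlyInverseˡ σ zero
  cone : Cone (adj G) x
  cone = record
    { symmetric = Graph.sym G
    ; irreflexive = Graph.irrefl G
    ; complete-off = λ i j ix jx → trans (G≡σK i j)
        (complete-permute σ (adjK k) x (subst (CompleteAwayFrom (adjK k)) (≡.sym σx) (Cone.complete-off (K-cone k))) i j ix jx) }
  degree : card (adj G x) ≡ k
  degree = begin
    card (adj G x)                         ≡⟨ card-cong _ _ (G≡σK x) ⟩
    card (permute σ (adjK k) x)            ≡⟨ degree-permute σ (adjK k) x ⟩
    card (adjK k (Inverse.to σ x))         ≡⟨ cong (λ z → card (adjK k z)) σx ⟩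
    card (adjK {suc (suc m)} k zero)       ≡⟨ degK m k k≤m+1 ⟩
    k                                      ∎

module CutArgument (m k : ℕ) (k≤m+1 : k ≤ suc m) (G : Graph (suc (suc m))) (connected : Connected G)
  (F : List (Pair (suc (suc m)))) (|F|≡k : length F ≡ k) (cut : Cut G F) where
  open Cut cut
  open CutCover m S

  -- The edges of G across the cut are all in F, since S is closed in G − F.
  crossing-edge∈F : ∀ p q → crossing p q ≡ true → adj G p q ≡ true → any (memPair p q) F ≡ true
  crossing-edge∈F p q pq-crosses pq∈G with S p in Sp | any (memPair p q) F in pq∈F
  ... | _ | true = refl
  ... | true | false with () ← trans (≡.sym (closed p q Sp (cong₂ (λ x y → x ∧ not y) pq∈G pq∈F))) (not-true pq-crosses)
  ... | false | false with () ← trans (≡.sym (closed q p pq-crosses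
          (cong₂ (λ x y → x ∧ not y) (trans (Graph.sym G q p) pq∈G) (trans (any-memPair-sym q p F) pq∈F)))) Sp

  G⊆cover : ∀ i j → adj G i j ≡ true → cover F i j ≡ true
  G⊆cover i j ij∈G with crossing i j in ij-crosses
  ... | true rewrite crossing-edge∈F i j ij-crosses ij∈G = ∨-comm _ true
  ... | false = cong (_∨ false) same-side
    where
    i≢j : (i == j) ≡ false
    i≢j = ≢⇒==false (λ { refl → true≢false (trans (≡.sym ij∈G) (Graph.irrefl G i)) })
    same-side : base i j ≡ true
    same-side rewrite i≢j = agree (S i) (S j) ij-crosses
      where
      agree : ∀ a b → a xor b ≡ false → ((a ∧ b) ∨ (not a ∧ not b)) ∧ true ≡ true
      agree true true _ = refl
      agree false false _ = refl

  ZG≤cover : Zᵃ (adj G) ≤ Zᵃ (cover F)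
  ZG≤cover = Zᵃ-mono (adj G) (cover F) (λ i j _ → G⊆cover i j)

  s t : ℕ
  s = card S
  t = card Sᶜ
  s+t : s + t ≡ suc (suc m)
  s+t = card-complement S

  -- Z(K_S ∪ K_Sᶜ) = Z(K_s)·Z(K_t) ≤ Z(K_{m+1}) since s, t ≥ 1.
  base≤ : Zᵃ base ≤ zK (suc m)
  base≤ = subst (_≤ zK (suc m)) (≡.sym (twoCliques-Z S Sᶜ Disjoint-S-Sᶜ))
                (product-bound s t refl refl (card-pos S u Su) (card-pos Sᶜ v (cong not Sv)))
    where
    product-bound : ∀ s' t' → s ≡ s' → t ≡ t' → 1 ≤ s' → 1 ≤ t' → zK s * zK t ≤ zK (suc m)
    product-bound (suc a) (suc b) s≡ t≡ _ _ rewrite s≡ | t≡ =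
      subst (λ z → zK (suc a) * zK (suc b) ≤ zK z) a+b+1≡m+1 (zK-product a b)
      where
      a+b+1≡m+1 : suc (a + b) ≡ suc m
      a+b+1≡m+1 = suc-injective (trans (cong suc (≡.sym (+-suc a b))) (trans (cong₂ _+_ (≡.sym s≡) (≡.sym t≡)) s+t))

  cover≤K : Zᵃ (cover F) ≤ Z (K (suc (suc m)) k)
  cover≤K = begin
    Zᵃ (cover F)                         ≤⟨ cover-bound F ⟩
    Zᵃ base + length F * zK m            ≤⟨ +-mono-≤ base≤ (≤-reflexive (cong (_* zK m) |F|≡k)) ⟩
    zK (suc m) + k * zK m                ≡⟨ Z-K m k k≤m+1 ⟨
    Z (K (suc (suc m)) k)                ∎
    where open ≤-Reasoning

  upper-bound : Z G ≤ Z (K (suc (suc m)) k)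
  upper-bound = subst (_≤ Z (K (suc (suc m)) k)) (≡.sym (Z≡Zᵃ G)) (≤-trans ZG≤cover cover≤K)

  equality⇒G=cover : Z G ≡ Z (K (suc (suc m)) k) → ∀ i j → toℕ i < toℕ j → adj G i j ≡ cover F i j
  equality⇒G=cover eq = Zᵃ-rigid (adj G) (cover F) (λ i j _ → G⊆cover i j)
    (≤-antisym ZG≤cover (subst (Zᵃ (cover F) ≤_) (trans (≡.sym eq) (Z≡Zᵃ G)) cover≤K))

  -- If all vertices but w lie on one side b of the cut, equality makes G a cone
  -- with apex w, and comparing Zᵃ-cone with Z-K gives deg w = k.
  lone-vertex : (w : Fin (suc (suc m))) (b : Bool) → (∀ i → (i == w) ≡ false → S i ≡ b) →
    Z G ≡ Z (K (suc (suc m)) k) → G ≅ K (suc (suc m)) k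
  lone-vertex w b one-side eq = cone-relabels m k k≤m+1 (adj G) w cone degree
    where
    complete< : ∀ i j → toℕ i < toℕ j → (i == w) ≡ false → (j == w) ≡ false → adj G i j ≡ complete i j
    complete< i j i<j iw jw =
      trans (equality⇒G=cover eq i j i<j) (cover-same-side F i j (trans (one-side i iw) (≡.sym (one-side j jw))))
    complete-off : CompleteAwayFrom (adj G) w
    complete-off i j iw jw with Fin.<-cmp i j
    ... | tri< i<j _ _ = complete< i j i<j iw jw
    ... | tri≈ _ refl _ = trans (Graph.irrefl G i) (cong not (≡.sym (==-refl i)))
    ... | tri> _ _ j<i = trans (Graph.sym G i j) (trans (complete< j i j<i jw iw) (cong not (==-sym j i)))
    cone : Cone (adj G) w
    cone = record { symmetric = Graph.sym G ; irreflexive = Graph.irrefl G ; complete-off = complete-off }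
    degree : card (adj G w) ≡ k
    degree = *-cancelʳ-≡ (card (adj G w)) k (zK m) {{>-nonZero (zK-pos m)}}
      (+-cancelˡ-≡ (zK (suc m)) _ _ (begin
        zK (suc m) + card (adj G w) * zK m     ≡⟨ Zᵃ-cone m (adj G) w cone ⟨
        Zᵃ (adj G)                             ≡⟨ Z≡Zᵃ G ⟨
        Z G                                    ≡⟨ eq ⟩
        Z (K (suc (suc m)) k)                  ≡⟨ Z-K m k k≤m+1 ⟩
        zK (suc m) + k * zK m                  ∎))
      where open ≡-Reasoning

  -- With at least two vertices on each side, every crossing contraction term
  -- of K_S ∪ K_Sᶜ is Z(K_{s-1})·Z(K_{t-1}) < Z(K_m).
  crossing-contraction-below : 2 ≤ s → 2 ≤ t → ∀ p q → S p ≡ true → S q ≡ false →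
    Zᵃ (deleteVertices p q base) < zK m
  crossing-contraction-below 2≤s 2≤t p q Sp Sq =
    subst (_< zK m) (≡.sym contracted) (zK-product-strict _ _ m (≤-pred (subst (2 ≤_) |S| 2≤s)) (≤-pred (subst (2 ≤_) |Sᶜ| 2≤t)) sizes)
    where
    p≢q : (p == q) ≡ false
    p≢q = ≢⇒==false (λ { refl → true≢false (trans (≡.sym Sp) Sq) })
    S'' = (S −ᵥ q) −ᵥ p
    Sᶜ'' = (Sᶜ −ᵥ q) −ᵥ p
    contracted : Zᵃ (deleteVertices p q base) ≡ zK (card S'') * zK (card Sᶜ'')
    contracted = trans (Zᵃ-cong _ _ (twoCliques-deleteVertices S Sᶜ p q))
                       (twoCliques-Z S'' Sᶜ'' (Disjoint-remove (S −ᵥ q) (Sᶜ −ᵥ q) p (Disjoint-remove S Sᶜ q Disjoint-S-Sᶜ)))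
    |S| : s ≡ suc (card S'')
    |S| = trans (card-remove-nonmember S q Sq) (card-remove-member (S −ᵥ q) p (cong₂ (λ x y → x ∧ not y) Sp p≢q))
    |Sᶜ| : t ≡ suc (card Sᶜ'')
    |Sᶜ| = trans (card-remove-member Sᶜ q (cong not Sq))
                 (cong suc (card-remove-nonmember (Sᶜ −ᵥ q) p (cong (λ x → not x ∧ not (p == q)) Sp)))
    sizes : card S'' + card Sᶜ'' ≡ m
    sizes = suc-injective (suc-injective (trans (cong suc (≡.sym (+-suc (card S'') (card Sᶜ''))))
                                                (trans (cong₂ _+_ (≡.sym |S|) (≡.sym |Sᶜ|)) s+t)))

  crossing-below : 2 ≤ s → 2 ≤ t → ∀ p q → crossing p q ≡ true → Zᵃ (deleteVertices p q base) < zK m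
  crossing-below 2≤s 2≤t p q pq-crosses with S p in Sp
  ... | true = crossing-contraction-below 2≤s 2≤t p q Sp (not-true pq-crosses)
  ... | false = subst (_< zK m) (Zᵃ-cong _ _ (deleteVertices-sym base q p))
                      (crossing-contraction-below 2≤s 2≤t q p pq-crosses Sp)

  -- Both sides large: G is connected, so some edge of G crosses the cut; it lies
  -- in F, and the strict cover bound applies.
  strict-bound : 2 ≤ s → 2 ≤ t → Z G < Z (K (suc (suc m)) k)
  strict-bound 2≤s 2≤t with leaving-edge G S (connected u v) Su Sv
  ... | p , q , Sp , Sq , pq∈G = begin-strict
    Z G                                  ≡⟨ Z≡Zᵃ G ⟩
    Zᵃ (adj G)                           ≤⟨ ZG≤cover ⟩
    Zᵃ (cover F)                         <⟨ n<1+n (Zᵃ (cover F)) ⟩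
    suc (Zᵃ (cover F))                   ≡⟨ +-comm 1 (Zᵃ (cover F)) ⟩
    Zᵃ (cover F) + 1                     ≡⟨ cong (λ b → Zᵃ (cover F) + when b 1) F-crosses ⟨
    Zᵃ (cover F) + when (crosses F) 1    ≤⟨ Strict.cover-bound-strict (crossing-below 2≤s 2≤t) F ⟩
    Zᵃ base + length F * zK m            ≤⟨ +-mono-≤ base≤ (≤-reflexive (cong (_* zK m) |F|≡k)) ⟩
    zK (suc m) + k * zK m                ≡⟨ Z-K m k k≤m+1 ⟨
    Z (K (suc (suc m)) k)                ∎
    where
    open ≤-Reasoning
    pq-crosses : crossing p q ≡ true
    pq-crosses rewrite Sp | Sq = refl
    F-crosses : crosses F ≡ true
    F-crosses = crosses-intro p q F pq-crosses (crossing-edge∈F p q pq-crosses pq∈G)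

  -- Equality: one side of the cut is a single vertex, so G is a cone over it.
  equality⇒≅ : Z G ≡ Z (K (suc (suc m)) k) → G ≅ K (suc (suc m)) k
  equality⇒≅ eq with s ≤? 1 | t ≤? 1
  ... | yes s≤1 | _ = lone-vertex u false (card≤1-singleton S u Su s≤1) eq
  ... | no _ | yes t≤1 = lone-vertex v true (λ i iv → not-false (card≤1-singleton Sᶜ v (cong not Sv) t≤1 i iv)) eq
  ... | no s≰1 | no t≰1 = ⊥-elim (<-irrefl eq (strict-bound (≰⇒> s≰1) (≰⇒> t≰1)))

theorem2p11 : (n k : ℕ) → 2 ≤ n → 1 ≤ k → k ≤ n ∸ 1 →
    (G : Graph n) → Connected G → EdgeConnectivity G k →
    (Z G ≤ Z (K n k)) × ((Z G ≡ Z (K n k)) ⇔ (G ≅ K n k))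
theorem2p11 (suc (suc m)) k (s≤s (s≤s z≤n)) _ k≤m+1 G connected (_ , F , |F|≡k , disconnects) =
  upper-bound , mk⇔ equality⇒≅ (relabel-Z m k k≤m+1 G)
  where open CutArgument m k k≤m+1 G connected F |F|≡k (disconnected⇒cut G F disconnects)
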